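{- Let $G$ be a finite simple graph of order $2n$ with a perfect matching. Then $F(G)\leq\frac{e(G)-n}{2}$, and equality holds if and only if $G$ is the vertex-disjoint union of $\frac{e(G)-n}{2}$ cycles of length $4$ and $2n-e(G)\geq 0$ independent edges (copies of $K_2$).
   Context: For a graph $G$ with a perfect matching $M$, a subset $S\subseteq M$ is a forcing set of $M$ if $S$ is contained in no perfect matching of $G$ other than $M$. $f(G,M)$ is the minimum size of a forcing set of $M$, and $F(G)=\max_M f(G,M)$ over all perfect matchings $M$ of $G$. $e(G)$ is the number of edges. -}

module Defs where

open import Data.Nat using (ℕ; zero; suc; _+_; _*_; _≤_; _<ᵇ_)
open import Data.Bool using (Bool; true; false; _∧_; if_then_else_)
open import Data.Fin using (Fin; toℕ)
open import Data.List using (List; []; _∷_; _++_; map; allFin; concatMap)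
open import Data.Nat.ListAction using (sum)
open import Data.List.Membership.Propositional using (_∈_)
open import Data.List.Relation.Unary.Any using (Any)
open import Data.List.Relation.Binary.Permutation.Propositional using (_↭_)
open import Data.Product using (Σ; _×_; _,_)
open import Relation.Binary.PropositionalEquality using (_≡_; _≢_)
open import Function.Bundles using (_⇔_)

record Graph (v : ℕ) : Set where
  field
    adj    : Fin v → Fin v → Bool
    sym    : ∀ i j → adj i j ≡ adj j i
    irrefl : ∀ i → adj i i ≡ false
open Graph public

pairCount : ∀ {v} → (Fin v → Fin v → Bool) → ℕ
pairCount {v} R =
  sum (map (λ i → sum (map (λ j → if (toℕ i <ᵇ toℕ j) ∧ R i j then 1 else 0)
                           (allFin v)))
           (allFin v))

e : ∀ {v} → Graph v → ℕ
e G = pairCount (adj G)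

record PerfectMatching {v} (G : Graph v) : Set where
  field
    partner : Fin v → Fin v
    invol   : ∀ i → partner (partner i) ≡ i
    noFix   : ∀ i → partner i ≢ i
    inG     : ∀ i → adj G i (partner i) ≡ true
open PerfectMatching public

record EdgeSet (v : ℕ) : Set where
  field
    mem    : Fin v → Fin v → Bool
    memSym : ∀ i j → mem i j ≡ mem j i
open EdgeSet public

size : ∀ {v} → EdgeSet v → ℕ
size S = pairCount (mem S)

_⊆M_ : ∀ {v} {G : Graph v} → EdgeSet v → PerfectMatching G → Set
S ⊆M M = ∀ i j → mem S i j ≡ true → partner M i ≡ j

IsForcingSet : ∀ {v} {G : Graph v} → PerfectMatching G → EdgeSet v → Set
IsForcingSet {G = G} M S =
  S ⊆M M × ((M' : PerfectMatching G) → S ⊆M M' → ∀ i → partner M' i ≡ partner M i)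

-- F(G) = k, i.e. max over M of min size of a forcing set of M equals k:
-- every M has a forcing set of size ≤ k, and some M has all forcing sets of size ≥ k.
IsMaxForcingNumber : ∀ {v} → Graph v → ℕ → Set
IsMaxForcingNumber {v} G k =
  ((M : PerfectMatching G) → Σ (EdgeSet v) λ S → IsForcingSet M S × size S ≤ k)
  × Σ (PerfectMatching G) λ M → (S : EdgeSet v) → IsForcingSet M S → k ≤ size S

data Comp (v : ℕ) : Set where
  C4 : Fin v → Fin v → Fin v → Fin v → Comp v
  K2 : Fin v → Fin v → Comp v

compVerts : ∀ {v} → Comp v → List (Fin v)
compVerts (C4 a b c d) = a ∷ b ∷ c ∷ d ∷ []
compVerts (K2 a b)     = a ∷ b ∷ []

compEdges : ∀ {v} → Comp v → List (Fin v × Fin v)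
compEdges (C4 a b c d) =
  (a , b) ∷ (b , a) ∷ (b , c) ∷ (c , b) ∷ (c , d) ∷ (d , c) ∷ (d , a) ∷ (a , d) ∷ []
compEdges (K2 a b) = (a , b) ∷ (b , a) ∷ []

numC4 : ∀ {v} → List (Comp v) → ℕ
numC4 []              = 0
numC4 (C4 _ _ _ _ ∷ cs) = suc (numC4 cs)
numC4 (K2 _ _ ∷ cs)   = numC4 cs

numK2 : ∀ {v} → List (Comp v) → ℕ
numK2 []              = 0
numK2 (C4 _ _ _ _ ∷ cs) = numK2 cs
numK2 (K2 _ _ ∷ cs)   = suc (numK2 cs)

IsUnionC4K2 : ∀ {v} → Graph v → ℕ → ℕ → Set
IsUnionC4K2 {v} G a b =
  Σ (List (Comp v)) λ cs →
      (concatMap compVerts cs ↭ allFin v)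
    × (∀ i j → (adj G i j ≡ true) ⇔ Any (λ c → (i , j) ∈ compEdges c) cs)
    × numC4 cs ≡ a
    × numK2 cs ≡ b

-- Let M be a perfect matching attaining F(G), and view a minimum forcing set of M as the
-- set U of 2·F(G) vertices it covers.  By minimality, dropping the M-edge at any u ∈ U
-- leaves a set that no longer forces M, and a perfect matching witnessing this sends u to
-- a neighbour outside U.  So at least |U| edges leave U; none of them is in M, hence
-- e(G) ≥ n + |U| = n + 2F(G).  In the equality case every edge lies in M or leaves U, each
-- u ∈ U has exactly one neighbour w(u) outside U, m(u) is adjacent to m(w(u)), and every
-- vertex outside U has at most one neighbour in U (otherwise the two M-edges at those
-- neighbours could be traded for one, giving a smaller forcing set).  Thus G splits into
-- the 4-cycles u, m(u), m(w(u)), w(u) and isolated M-edges.  Conversely, in such a union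
-- every forcing set contains an M-edge of each 4-cycle, since otherwise M could be
-- switched along that cycle.
module Submission where

open import Defs renaming (sym to adj-sym; irrefl to adj-irrefl)
open import Data.Bool using (Bool; true; false; _∧_; _∨_; not; if_then_else_; T)
open import Data.Bool.Properties using (∧-zeroʳ; ∧-identityʳ; ∨-comm; ∨-zeroʳ; ∧-assoc; ∧-inverseʳ)
  renaming (_≟_ to _≟ᵇ_)
open import Data.Empty using (⊥; ⊥-elim)
open import Data.Fin using (Fin; toℕ; zero; suc)
open import Data.Fin.Permutation.Components using (transpose; transpose-inverse)
open import Data.Fin.Properties using (_≟_; any?; all?; toℕ-injective)
  renaming (suc-injective to fsuc-injective)
open import Data.List using (List; []; _∷_; _++_; length; map; concatMap; allFin; tabulate)
open import Data.List.Membership.Propositional using (_∈_; lose; find)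
open import Data.List.Membership.Propositional.Properties using (∈-allFin)
open import Data.List.Membership.Propositional.Properties.WithK using (unique∧set⇒bag)
open import Data.List.Properties using (concatMap-++; length-tabulate)
open import Data.List.Relation.Binary.BagAndSetEquality using (∼bag⇒↭)
open import Data.List.Relation.Binary.Disjoint.Propositional using (Disjoint)
open import Data.List.Relation.Binary.Permutation.Propositional using (_↭_; ↭-sym; ↭⇒↭ₛ′)
open import Data.List.Relation.Binary.Permutation.Propositional.Properties using (↭-length; map⁺)
import Data.List.Relation.Binary.Permutation.Setoid.Properties as PermutationSetoid
open import Data.List.Relation.Unary.All using ([]; _∷_)
import Data.List.Relation.Unary.All as All
import Data.List.Relation.Unary.All.Properties as All
open import Data.List.Relation.Unary.AllPairs using ([]; _∷_)
import Data.List.Relation.Unary.AllPairs as AllPairs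
import Data.List.Relation.Unary.AllPairs.Properties as AllPairs
open import Data.List.Relation.Unary.Any using (Any; here; there)
open import Data.List.Relation.Unary.Any.Properties using (++⁺ˡ; ++⁺ʳ; concatMap⁺; concatMap⁻)
open import Data.List.Relation.Unary.Unique.Propositional using (Unique)
open import Data.List.Relation.Unary.Unique.Propositional.Properties using (concat⁺; allFin⁺)
open import Data.Nat using (ℕ; zero; suc; _+_; _*_; _≤_; _<_; _<ᵇ_; z≤n; s≤s)
open import Data.Nat.Induction using (<-rec)
import Data.Nat.ListAction as List
open import Data.Nat.ListAction.Properties using (sum-↭)
open import Data.Nat.Properties hiding (_≟_)
open import Algebra.Properties.CommutativeMonoid.Sum +-0-commutativeMonoid
  using (sum; sum-syntax; ∑-distrib-+; ∑-comm; sum-cong-≗)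
open import Data.Product using (Σ; ∃; _×_; _,_; proj₁; proj₂)
open import Data.Sum using (_⊎_; inj₁; inj₂)
open import Data.Vec.Functional using () renaming (_∷_ to _◂_)
open import Function using (_∘_)
open import Function.Bundles using (_⇔_; mk⇔; Equivalence)
open import Level using (0ℓ)
open import Relation.Binary.Core using (Rel)
open import Relation.Binary.Definitions using (_Respects_; Symmetric; tri<; tri≈; tri>)
open import Relation.Binary.PropositionalEquality
open import Relation.Nullary using (¬_; Dec; yes; no; does; ¬?)
open import Relation.Nullary.Decidable using (_×-dec_; _→-dec_; dec-true; dec-false; decidable-stable)
open import Relation.Nullary.Negation using (contradiction)
open import Relation.Unary using (Decidable)

open Equivalence using (to; from)

-- Counting over Fin n

⟦_⟧ : Bool → ℕ
⟦ b ⟧ = if b then 1 else 0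

count : ∀ {n} → (Fin n → Bool) → ℕ
count {n} U = ∑[ i < n ] ⟦ U i ⟧

sum-mono-≤ : ∀ {n} {f g : Fin n → ℕ} → (∀ i → f i ≤ g i) → sum f ≤ sum g
sum-mono-≤ {zero}  f≤g = z≤n
sum-mono-≤ {suc n} f≤g = +-mono-≤ (f≤g zero) (sum-mono-≤ (f≤g ∘ suc))

sum-mono-< : ∀ {n} {f g : Fin n → ℕ} (c : Fin n) → (∀ i → f i ≤ g i) → f c < g c → sum f < sum g
sum-mono-< zero    f≤g fc<gc = +-mono-<-≤ fc<gc (sum-mono-≤ (f≤g ∘ suc))
sum-mono-< (suc c) f≤g fc<gc = +-mono-≤-< (f≤g zero) (sum-mono-< c (f≤g ∘ suc) fc<gc)

sum-rigid : ∀ {n} {f g : Fin n → ℕ} → (∀ i → f i ≤ g i) → sum g ≤ sum f → ∀ i → g i ≤ f i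
sum-rigid {f = f} {g} f≤g Σg≤Σf i with g i ≤? f i
... | yes gi≤fi = gi≤fi
... | no  gi≰fi = contradiction Σg≤Σf (<⇒≱ (sum-mono-< i f≤g (≰⇒> gi≰fi)))

term≤sum : ∀ {n} (f : Fin n → ℕ) (c : Fin n) → f c ≤ sum f
term≤sum f zero    = m≤m+n _ _
term≤sum f (suc c) = ≤-trans (term≤sum (f ∘ suc) c) (m≤n+m _ _)

two-terms≤sum : ∀ {n} (f : Fin n → ℕ) {a b : Fin n} → a ≢ b → f a + f b ≤ sum f
two-terms≤sum f {zero}  {zero}  a≢b = contradiction refl a≢b
two-terms≤sum f {zero}  {suc b} a≢b = +-monoʳ-≤ (f zero) (term≤sum (f ∘ suc) b)
two-terms≤sum f {suc a} {zero}  a≢b =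
  subst (_≤ sum f) (+-comm (f zero) (f (suc a))) (+-monoʳ-≤ (f zero) (term≤sum (f ∘ suc) a))
two-terms≤sum f {suc a} {suc b} a≢b =
  ≤-trans (two-terms≤sum (f ∘ suc) (a≢b ∘ cong suc)) (m≤n+m _ _)

sum-zero : ∀ {n} {f : Fin n → ℕ} → (∀ i → f i ≡ 0) → sum f ≡ 0
sum-zero {zero}  f≡0 = refl
sum-zero {suc n} f≡0 = cong₂ _+_ (f≡0 zero) (sum-zero (f≡0 ∘ suc))

sum-supportedAt : ∀ {n} {f : Fin n → ℕ} (c : Fin n) → (∀ i → i ≢ c → f i ≡ 0) → sum f ≡ f c
sum-supportedAt {f = f} zero    f≡0 =
  trans (cong (f zero +_) (sum-zero (λ i → f≡0 (suc i) λ ()))) (+-identityʳ (f zero))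
sum-supportedAt {f = f} (suc c) f≡0 =
  cong₂ _+_ (f≡0 zero λ ()) (sum-supportedAt c (λ i i≢c → f≡0 (suc i) (i≢c ∘ fsuc-injective)))

count-true : ∀ n → count {n} (λ _ → true) ≡ n
count-true zero    = refl
count-true (suc n) = cong suc (count-true n)

list-sum-tabulate : ∀ {n} {A : Set} (f : A → ℕ) (g : Fin n → A) →
                    List.sum (map f (tabulate g)) ≡ ∑[ i < n ] f (g i)
list-sum-tabulate {zero}  f g = refl
list-sum-tabulate {suc n} f g = cong (f (g zero) +_) (list-sum-tabulate f (g ∘ suc))

list-sum-allFin : ∀ {n} (f : Fin n → ℕ) → List.sum (map f (allFin n)) ≡ sum f
list-sum-allFin f = list-sum-tabulate f (λ i → i)

infix 7 _≺_

_≺_ : ∀ {n} → Fin n → Fin n → Bool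
i ≺ j = toℕ i <ᵇ toℕ j

<⇒≺ : ∀ {n} {i j : Fin n} → toℕ i < toℕ j → (i ≺ j) ≡ true
<⇒≺ {i = i} {j} i<j with i ≺ j | <⇒<ᵇ i<j
... | true | _ = refl

≮⇒≺-false : ∀ {n} {i j : Fin n} → ¬ toℕ i < toℕ j → (i ≺ j) ≡ false
≮⇒≺-false {i = i} {j} i≮j with i ≺ j in i≺j
... | false = refl
... | true  = contradiction (<ᵇ⇒< (toℕ i) (toℕ j) (subst T (sym i≺j) _)) i≮j

≺-irrefl : ∀ {n} (i : Fin n) → (i ≺ i) ≡ false
≺-irrefl i = ≮⇒≺-false {i = i} {j = i} (<-irrefl refl)

≺-flip : ∀ {n} {i j : Fin n} → i ≢ j → (j ≺ i) ≡ not (i ≺ j)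
≺-flip {i = i} {j} i≢j with <-cmp (toℕ i) (toℕ j)
... | tri< i<j _ j≮i rewrite <⇒≺ i<j | ≮⇒≺-false j≮i = refl
... | tri≈ _ i≡j _   = contradiction (toℕ-injective i≡j) i≢j
... | tri> i≮j _ j<i rewrite ≮⇒≺-false i≮j | <⇒≺ j<i = refl

⟦⟧-split-≺ : ∀ {n} {i j : Fin n} → i ≢ j → ∀ r →
             ⟦ r ⟧ ≡ ⟦ i ≺ j ∧ r ⟧ + ⟦ j ≺ i ∧ r ⟧
⟦⟧-split-≺ {i = i} {j} i≢j r rewrite ≺-flip i≢j = split (i ≺ j) r
  where
  split : ∀ a r → ⟦ r ⟧ ≡ ⟦ a ∧ r ⟧ + ⟦ not a ∧ r ⟧
  split true  r = sym (+-identityʳ ⟦ r ⟧)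
  split false r = refl

pairCount-sum : ∀ {n} (R : Fin n → Fin n → Bool) →
                pairCount R ≡ ∑[ i < n ] ∑[ j < n ] ⟦ i ≺ j ∧ R i j ⟧
pairCount-sum {n} R =
  trans (list-sum-allFin (λ i → List.sum (map (λ j → ⟦ i ≺ j ∧ R i j ⟧) (allFin n))))
        (sum-cong-≗ (λ i → list-sum-allFin (λ j → ⟦ i ≺ j ∧ R i j ⟧)))

handshake : ∀ {n} (R : Fin n → Fin n → Bool) → (∀ i → R i i ≡ false) →
            (∀ i j → R i j ≡ R j i) → ∑[ i < n ] ∑[ j < n ] ⟦ R i j ⟧ ≡ 2 * pairCount R
handshake {n} R irrefl sym-R = begin
  ∑[ i < n ] ∑[ j < n ] ⟦ R i j ⟧
    ≡⟨ sum-cong-≗ (λ i → sum-cong-≗ (split i)) ⟩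
  ∑[ i < n ] ∑[ j < n ] (below i j + above i j)
    ≡⟨ sum-cong-≗ (λ i → ∑-distrib-+ (below i) (above i)) ⟩
  ∑[ i < n ] (∑[ j < n ] below i j + ∑[ j < n ] above i j)
    ≡⟨ ∑-distrib-+ (λ i → ∑[ j < n ] below i j) (λ i → ∑[ j < n ] above i j) ⟩
  P + ∑[ i < n ] ∑[ j < n ] above i j
    ≡⟨ cong (P +_) (∑-comm above) ⟩
  P + ∑[ j < n ] ∑[ i < n ] above i j
    ≡⟨ cong (P +_) (sum-cong-≗ λ j → sum-cong-≗ λ i → cong (λ r → ⟦ j ≺ i ∧ r ⟧) (sym-R i j)) ⟩
  P + P
    ≡⟨ cong (P +_) (+-identityʳ P) ⟨
  2 * P
    ≡⟨ cong (2 *_) (pairCount-sum R) ⟨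
  2 * pairCount R ∎
  where
  open ≡-Reasoning
  below above : Fin n → Fin n → ℕ
  below i j = ⟦ i ≺ j ∧ R i j ⟧
  above i j = ⟦ j ≺ i ∧ R i j ⟧
  P : ℕ
  P = ∑[ i < n ] ∑[ j < n ] below i j
  split : ∀ i j → ⟦ R i j ⟧ ≡ ⟦ i ≺ j ∧ R i j ⟧ + ⟦ j ≺ i ∧ R i j ⟧
  split i j with i ≟ j
  ... | yes refl rewrite irrefl i | ≺-irrefl i = refl
  ... | no i≢j = ⟦⟧-split-≺ i≢j (R i j)

infixr 7 _∩_
infixr 6 _∪_ _∖_

_∪_ _∩_ _∖_ : ∀ {n} → (Fin n → Bool) → (Fin n → Bool) → Fin n → Bool
(A ∪ B) i = A i ∨ B i
(A ∩ B) i = A i ∧ B i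
(A ∖ B) i = A i ∧ not (B i)

⁅_⁆ : ∀ {n} → Fin n → Fin n → Bool
⁅ a ⁆ i = does (i ≟ a)

true≢false-at : ∀ {A : Set} {P : A → Bool} {x y} → P x ≡ true → P y ≡ false → x ≢ y
true≢false-at Px Py refl = contradiction (trans (sym Px) Py) λ ()

count-∪≤ : ∀ {n} (A B : Fin n → Bool) → count (A ∪ B) ≤ count A + count B
count-∪≤ A B = ≤-trans (sum-mono-≤ λ i → pointwise (A i) (B i))
                       (≤-reflexive (∑-distrib-+ (λ i → ⟦ A i ⟧) (λ i → ⟦ B i ⟧)))
  where
  pointwise : ∀ a b → ⟦ a ∨ b ⟧ ≤ ⟦ a ⟧ + ⟦ b ⟧
  pointwise true  b = s≤s z≤n
  pointwise false b = ≤-refl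

count-∪-disjoint : ∀ {n} (A B : Fin n → Bool) → (∀ i → (A ∩ B) i ≡ false) →
                   count (A ∪ B) ≡ count A + count B
count-∪-disjoint A B disjoint = trans (sum-cong-≗ λ i → pointwise (A i) (B i) (disjoint i))
                                      (∑-distrib-+ (λ i → ⟦ A i ⟧) (λ i → ⟦ B i ⟧))
  where
  pointwise : ∀ a b → a ∧ b ≡ false → ⟦ a ∨ b ⟧ ≡ ⟦ a ⟧ + ⟦ b ⟧
  pointwise true  false _ = refl
  pointwise false b     _ = refl

count-∖-⊆ : ∀ {n} (A B : Fin n → Bool) → (∀ i → B i ≡ true → A i ≡ true) →
            count (A ∖ B) + count B ≡ count A
count-∖-⊆ A B B⊆A = trans (sym (∑-distrib-+ (λ i → ⟦ (A ∖ B) i ⟧) (λ i → ⟦ B i ⟧)))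
                          (sum-cong-≗ λ i → pointwise (A i) (B i) (B⊆A i))
  where
  pointwise : ∀ a b → (b ≡ true → a ≡ true) → ⟦ a ∧ not b ⟧ + ⟦ b ⟧ ≡ ⟦ a ⟧
  pointwise true  true  _   = refl
  pointwise true  false _   = refl
  pointwise false false _   = refl
  pointwise false true  b⇒a = contradiction (b⇒a refl) λ ()

count-⁅⁆ : ∀ {n} (a : Fin n) → count ⁅ a ⁆ ≡ 1
count-⁅⁆ a = trans (sum-supportedAt a λ i i≢a → cong ⟦_⟧ (dec-false (i ≟ a) i≢a))
                   (cong ⟦_⟧ (dec-true (a ≟ a) refl))

-- Exhaustive search

Searchable : (A : Set) → Rel A 0ℓ → Set₁
Searchable A _≈_ = ∀ {P : A → Set} → P Respects _≈_ → Decidable P → Dec (∃ P)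

searchable-Fin : ∀ {n} → Searchable (Fin n) _≡_
searchable-Fin _ P? = any? P?

searchable-Bool : Searchable Bool _≡_
searchable-Bool _ P? with P? true | P? false
... | yes pt | _      = yes (true , pt)
... | no _   | yes pf = yes (false , pf)
... | no ¬pt | no ¬pf = no λ { (true , pt) → ¬pt pt ; (false , pf) → ¬pf pf }

searchable-→ : ∀ {B : Set} → Searchable B _≡_ → ∀ n → Searchable (Fin n → B) _≗_
searchable-→ search-B zero resp P? with P? (λ ())
... | yes p = yes ((λ ()) , p)
... | no ¬p = no λ { (f , pf) → ¬p (resp (λ ()) pf) }
searchable-→ {B} search-B (suc n) {P} resp P?
  with search-B {λ b → ∃ λ (f : Fin n → B) → P (b ◂ f)} (λ { refl q → q })
         (λ b → searchable-→ search-B n (λ f≗g → resp λ { zero → refl ; (suc i) → f≗g i })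
                  (λ f → P? (b ◂ f)))
... | yes (b , f , p) = yes (b ◂ f , p)
... | no ¬p = no λ { (f , pf) → ¬p (f zero , f ∘ suc , resp (λ { zero → refl ; (suc i) → refl }) pf) }

module SearchableQuantifiers {A : Set} {_≈_ : Rel A 0ℓ} (search : Searchable A _≈_) (≈-sym : Symmetric _≈_)
         {P : A → Set} (resp : P Respects _≈_) (P? : Decidable P) where

  private
    counterexample? : Dec (∃ λ x → ¬ P x)
    counterexample? = search (λ x≈y ¬Px Py → ¬Px (resp (≈-sym x≈y) Py)) (λ x → ¬? (P? x))

  searchable-all? : Dec (∀ x → P x)
  searchable-all? with counterexample?
  ... | yes (x , ¬Px) = no λ all → ¬Px (all x)
  ... | no none = yes λ x → decidable-stable (P? x) λ ¬Px → none (x , ¬Px)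

  searchable-¬∀⇒∃¬ : ¬ (∀ x → P x) → ∃ λ x → ¬ P x
  searchable-¬∀⇒∃¬ ¬all with counterexample?
  ... | yes found = found
  ... | no none = contradiction (λ x → decidable-stable (P? x) λ ¬Px → none (x , ¬Px)) ¬all

Least : (ℕ → Set) → ℕ → Set
Least P k = P k × (∀ j → j < k → ¬ P j)

least : ∀ {P : ℕ → Set} → Decidable P → ∀ {N} → P N → ∃ (Least P)
least {P} P? {N} = <-rec (λ N → P N → ∃ (Least P)) step N
  where
  step : ∀ N → (∀ {j} → j < N → P j → ∃ (Least P)) → P N → ∃ (Least P)
  step N below PN with anyUpTo? P? N
  ... | yes (j , j<N , Pj) = below j<N Pj
  ... | no none = N , PN , λ j j<N Pj → none (j , j<N , Pj)

-- Perfect matchings and forcing sets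

infix 4 _≈ᴹ_

_≈ᴹ_ : ∀ {v} {G : Graph v} → PerfectMatching G → PerfectMatching G → Set
M ≈ᴹ M' = partner M ≗ partner M'

module _ {v : ℕ} (G : Graph v) where

  IsPerfectMatching : (Fin v → Fin v) → Set
  IsPerfectMatching p = (∀ i → p (p i) ≡ i) × (∀ i → p i ≢ i) × (∀ i → adj G i (p i) ≡ true)

  isPerfectMatching? : Decidable IsPerfectMatching
  isPerfectMatching? p = all? (λ i → p (p i) ≟ i) ×-dec all? (λ i → ¬? (p i ≟ i))
                     ×-dec all? (λ i → adj G i (p i) ≟ᵇ true)

  isPerfectMatching-resp : IsPerfectMatching Respects _≗_
  isPerfectMatching-resp {p} {q} p≗q (invol-p , noFix-p , inG-p) =
    (λ i → trans (sym (p≗q (q i))) (trans (cong p (sym (p≗q i))) (invol-p i))) ,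
    (λ i → noFix-p i ∘ trans (p≗q i)) ,
    (λ i → trans (cong (adj G i) (sym (p≗q i))) (inG-p i))

  toPerfectMatching : ∀ {p} → IsPerfectMatching p → PerfectMatching G
  toPerfectMatching {p} (invol-p , noFix-p , inG-p) =
    record { partner = p ; invol = invol-p ; noFix = noFix-p ; inG = inG-p }

  private
    decide : ∀ {P : PerfectMatching G → Set} → P Respects _≈ᴹ_ → Decidable P →
             Decidable (λ p → Σ (IsPerfectMatching p) (P ∘ toPerfectMatching))
    decide resp P? p with isPerfectMatching? p
    ... | no ¬pm = no (¬pm ∘ proj₁)
    ... | yes pm with P? (toPerfectMatching pm)
    ...   | yes Pp = yes (pm , Pp)
    ...   | no ¬Pp = no λ (_ , Pp) → ¬Pp (resp (λ _ → refl) Pp)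

  searchable-PerfectMatching : Searchable (PerfectMatching G) _≈ᴹ_
  searchable-PerfectMatching {P} resp P?
    with searchable-→ searchable-Fin v {λ p → Σ (IsPerfectMatching p) (P ∘ toPerfectMatching)}
           (λ p≗q (pm , Pp) → isPerfectMatching-resp p≗q pm , resp p≗q Pp) (decide resp P?)
  ... | yes (_ , pm , Pp) = yes (toPerfectMatching pm , Pp)
  ... | no ¬found = no λ (M , PM) → ¬found (partner M , (invol M , noFix M , inG M) , PM)

-- A subset of M is encoded by the vertex set it covers; the subsets of M are exactly the
-- closed vertex sets.
module _ {v : ℕ} {G : Graph v} (M : PerfectMatching G) where

  private
    m : Fin v → Fin v
    m = partner M

  AgreesOn : PerfectMatching G → (Fin v → Bool) → Set
  AgreesOn M' U = ∀ i → U i ≡ true → partner M' i ≡ m i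

  Forces : (Fin v → Bool) → Set
  Forces U = ∀ M' → AgreesOn M' U → M' ≈ᴹ M

  Closed : (Fin v → Bool) → Set
  Closed U = ∀ i → U (m i) ≡ U i

  Counterexample : (Fin v → Bool) → PerfectMatching G → Set
  Counterexample U M' = AgreesOn M' U × ∃ λ i → partner M' i ≢ m i

  private
    counterexample? : ∀ U → Dec (∃ (Counterexample U))
    counterexample? U = searchable-PerfectMatching G
      (λ M'≈M'' (agree , i , differ) →
         (λ j Uj → trans (sym (M'≈M'' j)) (agree j Uj)) , i , differ ∘ trans (M'≈M'' i))
      (λ M' → all? (λ i → (U i ≟ᵇ true) →-dec (partner M' i ≟ m i))
              ×-dec any? (λ i → ¬? (partner M' i ≟ m i)))

    forces-if-none : ∀ {U} → ¬ ∃ (Counterexample U) → Forces U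
    forces-if-none none M' agree i with partner M' i ≟ m i
    ... | yes same  = same
    ... | no differ = contradiction (M' , agree , i , differ) none

  ¬Forces⇒counterexample : ∀ {U} → ¬ Forces U → ∃ (Counterexample U)
  ¬Forces⇒counterexample {U} ¬forces with counterexample? U
  ... | yes found = found
  ... | no none   = contradiction (forces-if-none none) ¬forces

  forces? : Decidable Forces
  forces? U with counterexample? U
  ... | yes (M' , agree , i , differ) = no λ forces → differ (forces M' agree i)
  ... | no none = yes (forces-if-none none)

  partner-injective : ∀ {i j} → m i ≡ m j → i ≡ j
  partner-injective {i} {j} mi≡mj = trans (sym (invol M i)) (trans (cong m mi≡mj) (invol M j))

  partner-swap : ∀ {i j} → j ≡ m i → i ≡ m j
  partner-swap {i} refl = sym (invol M i)

  ≟-partner : ∀ i j → does (m i ≟ j) ≡ does (i ≟ m j)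
  ≟-partner i j with i ≟ m j
  ... | yes i≡mj = dec-true (m i ≟ j) (sym (partner-swap i≡mj))
  ... | no  i≢mj = dec-false (m i ≟ j) (i≢mj ∘ partner-swap ∘ sym)

  edgesOf : (U : Fin v → Bool) → Closed U → EdgeSet v
  edgesOf U closed = record { mem = mem′ ; memSym = mem′-sym }
    where
    mem′ : Fin v → Fin v → Bool
    mem′ i j = U i ∧ does (j ≟ m i)
    mem′-sym : ∀ i j → mem′ i j ≡ mem′ j i
    mem′-sym i j with j ≟ m i
    ... | yes refl rewrite dec-true (i ≟ m (m i)) (partner-swap refl) = cong (_∧ true) (sym (closed i))
    ... | no j≢mi rewrite dec-false (i ≟ m j) (j≢mi ∘ partner-swap) =
      trans (∧-zeroʳ (U i)) (sym (∧-zeroʳ (U j)))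

  verticesOf : EdgeSet v → Fin v → Bool
  verticesOf S i = mem S i (m i)

  module _ {U : Fin v → Bool} (closed : Closed U) where

    edgesOf-forcing : Forces U → IsForcingSet M (edgesOf U closed)
    edgesOf-forcing forces = ⊆M , λ M' ⊆M' → forces M' λ i Ui → ⊆M' i (m i) (on-matching i Ui)
      where
      ⊆M : edgesOf U closed ⊆M M
      ⊆M i j Uij with j ≟ m i
      ... | yes j≡mi = sym j≡mi
      ... | no _     = contradiction (trans (sym (∧-zeroʳ (U i))) Uij) λ ()
      on-matching : ∀ i → U i ≡ true → mem (edgesOf U closed) i (m i) ≡ true
      on-matching i Ui rewrite dec-true (m i ≟ m i) refl | Ui = refl

    size-edgesOf : size (edgesOf U closed) ≡ ∑[ i < v ] ⟦ i ≺ m i ∧ U i ⟧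
    size-edgesOf = trans (pairCount-sum (mem (edgesOf U closed))) (sum-cong-≗ row)
      where
      row : ∀ i → ∑[ j < v ] ⟦ i ≺ j ∧ (U i ∧ does (j ≟ m i)) ⟧ ≡ ⟦ i ≺ m i ∧ U i ⟧
      row i = trans (sum-supportedAt (m i) off) on
        where
        off : ∀ j → j ≢ m i → ⟦ i ≺ j ∧ (U i ∧ does (j ≟ m i)) ⟧ ≡ 0
        off j j≢mi rewrite dec-false (j ≟ m i) j≢mi | ∧-zeroʳ (U i) | ∧-zeroʳ (i ≺ j) = refl
        on : ⟦ i ≺ m i ∧ (U i ∧ does (m i ≟ m i)) ⟧ ≡ ⟦ i ≺ m i ∧ U i ⟧
        on rewrite dec-true (m i ≟ m i) refl | ∧-identityʳ (U i) = refl

    2*size-edgesOf : 2 * size (edgesOf U closed) ≡ count U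
    2*size-edgesOf = trans (sym (handshake (mem S) irrefl (memSym S))) (sum-cong-≗ row)
      where
      S : EdgeSet v
      S = edgesOf U closed
      irrefl : ∀ i → mem S i i ≡ false
      irrefl i rewrite dec-false (i ≟ m i) (noFix M i ∘ sym) = ∧-zeroʳ (U i)
      row : ∀ i → ∑[ j < v ] ⟦ mem S i j ⟧ ≡ ⟦ U i ⟧
      row i = trans (sum-supportedAt (m i) off) on
        where
        off : ∀ j → j ≢ m i → ⟦ U i ∧ does (j ≟ m i) ⟧ ≡ 0
        off j j≢mi rewrite dec-false (j ≟ m i) j≢mi | ∧-zeroʳ (U i) = refl
        on : ⟦ U i ∧ does (m i ≟ m i) ⟧ ≡ ⟦ U i ⟧
        on rewrite dec-true (m i ≟ m i) refl | ∧-identityʳ (U i) = refl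

  verticesOf-closed : ∀ S → Closed (verticesOf S)
  verticesOf-closed S i = trans (cong (mem S (m i)) (invol M i)) (memSym S (m i) i)

  verticesOf-forcing : ∀ {S} → IsForcingSet M S → Forces (verticesOf S)
  verticesOf-forcing {S} (S⊆M , unique) M' agree = unique M' λ i j Sij →
    let mi≡j = S⊆M i j Sij in
    trans (agree i (subst (λ k → mem S i k ≡ true) (sym mi≡j) Sij)) mi≡j

  count-verticesOf : ∀ {S} → S ⊆M M → count (verticesOf S) ≤ 2 * size S
  count-verticesOf {S} S⊆M = ≤-trans (sum-mono-≤ λ i → term≤sum (λ j → ⟦ mem S i j ⟧) (m i))
                                     (≤-reflexive (handshake (mem S) irrefl (memSym S)))
    where
    irrefl : ∀ i → mem S i i ≡ false
    irrefl i with mem S i i in Sii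
    ... | false = refl
    ... | true  = contradiction (S⊆M i i Sii) (noFix M i)

  closed-∪ : ∀ {A B} → Closed A → Closed B → Closed (A ∪ B)
  closed-∪ A-closed B-closed i = cong₂ _∨_ (A-closed i) (B-closed i)

  closed-∖ : ∀ {A B} → Closed A → Closed B → Closed (A ∖ B)
  closed-∖ A-closed B-closed i = cong₂ (λ a b → a ∧ not b) (A-closed i) (B-closed i)

  matchedPair : Fin v → Fin v → Bool
  matchedPair a = ⁅ a ⁆ ∪ ⁅ m a ⁆

  closed-matchedPair : ∀ a → Closed (matchedPair a)
  closed-matchedPair a i =
    trans (cong₂ _∨_ (≟-partner i a) (trans (≟-partner i (m a)) (cong (does ∘ (i ≟_)) (invol M a))))
          (∨-comm (does (i ≟ m a)) (does (i ≟ a)))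

  count-matchedPair : ∀ a → count (matchedPair a) ≡ 2
  count-matchedPair a =
    trans (count-∪-disjoint ⁅ a ⁆ ⁅ m a ⁆ disjoint) (cong₂ _+_ (count-⁅⁆ a) (count-⁅⁆ (m a)))
    where
    disjoint : ∀ i → (⁅ a ⁆ ∩ ⁅ m a ⁆) i ≡ false
    disjoint i with i ≟ a
    ... | yes refl = dec-false (i ≟ m i) (noFix M i ∘ sym)
    ... | no  _    = refl

  matchedPair-self : ∀ a → matchedPair a a ≡ true
  matchedPair-self a rewrite dec-true (a ≟ a) refl = refl

  matchedPair-elim : ∀ {a i} → matchedPair a i ≡ true → i ≡ a ⊎ i ≡ m a
  matchedPair-elim {a} {i} i∈a with i ≟ a | i ≟ m a
  ... | yes i≡a | _        = inj₁ i≡a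
  ... | no  _   | yes i≡ma = inj₂ i≡ma
  ... | no  _   | no  _    = contradiction i∈a λ ()

module _ {v : ℕ} {G : Graph v} {M M' : PerfectMatching G} (M≈M' : M ≈ᴹ M') where

  closed-resp : ∀ {U} → Closed M U → Closed M' U
  closed-resp {U} closed i = trans (cong U (sym (M≈M' i))) (closed i)

  forces-resp : ∀ {U} → Forces M U → Forces M' U
  forces-resp forces M'' agree i =
    trans (forces M'' (λ j Uj → trans (agree j Uj) (sym (M≈M' j))) i) (M≈M' i)

-- Minimum forcing sets and the maximum forcing number

HasClosedForcingSet≤ : ∀ {v} {G : Graph v} → PerfectMatching G → ℕ → Set
HasClosedForcingSet≤ M c = ∃ λ U → Closed M U × Forces M U × count U ≤ c

record MinimumClosedForcingSet {v} {G : Graph v} (M : PerfectMatching G) : Set where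
  field
    U       : Fin v → Bool
    closed  : Closed M U
    forces  : Forces M U
    minimal : ∀ U' → Closed M U' → Forces M U' → count U ≤ count U'

module _ {v : ℕ} {G : Graph v} where

  hasClosedForcingSet≤-resp : ∀ {c} {M M' : PerfectMatching G} →
                              M ≈ᴹ M' → HasClosedForcingSet≤ M c → HasClosedForcingSet≤ M' c
  hasClosedForcingSet≤-resp {M = M} {M'} M≈M' (U , closed , forces , U≤c) =
    U , closed-resp {M = M} {M'} M≈M' closed , forces-resp {M = M} {M'} M≈M' forces , U≤c

  hasClosedForcingSet≤? : ∀ (M : PerfectMatching G) c → Dec (HasClosedForcingSet≤ M c)
  hasClosedForcingSet≤? M c = searchable-→ searchable-Bool v {λ U → Closed M U × Forces M U × count U ≤ c}
    (λ U≗U' (closed , forces , U≤c) →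
       (λ i → trans (sym (U≗U' (partner M i))) (trans (closed i) (U≗U' i))) ,
       (λ M' agree → forces M' λ i Ui → agree i (trans (sym (U≗U' i)) Ui)) ,
       subst (_≤ c) (sum-cong-≗ (cong ⟦_⟧ ∘ U≗U')) U≤c)
    (λ U → all? (λ i → U (partner M i) ≟ᵇ U i) ×-dec forces? M U ×-dec count U ≤? c)

  hasClosedForcingSet≤-everything : ∀ (M : PerfectMatching G) → HasClosedForcingSet≤ M v
  hasClosedForcingSet≤-everything M =
    (λ _ → true) , (λ _ → refl) , (λ M' agree i → agree i refl) , ≤-reflexive (count-true v)

  minimumClosedForcingSet : ∀ (M : PerfectMatching G) → MinimumClosedForcingSet M
  minimumClosedForcingSet M with least (hasClosedForcingSet≤? M) (hasClosedForcingSet≤-everything M)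
  ... | c , (U , closed , forces , U≤c) , below = record
    { U       = U
    ; closed  = closed
    ; forces  = forces
    ; minimal = λ U' closed' forces' →
        ≤-trans U≤c (≮⇒≥ λ U'<c → below (count U') U'<c (U' , closed' , forces' , ≤-refl))
    }

  AllHaveClosedForcingSet≤ : ℕ → Set
  AllHaveClosedForcingSet≤ c = ∀ (M : PerfectMatching G) → HasClosedForcingSet≤ M c

  private
    module Search c = SearchableQuantifiers (searchable-PerfectMatching G) (λ M≈M' i → sym (M≈M' i))
                        (λ {M} {M'} → hasClosedForcingSet≤-resp {c = c} {M} {M'})
                        (λ M → hasClosedForcingSet≤? M c)

  allHaveClosedForcingSet≤? : Decidable AllHaveClosedForcingSet≤
  allHaveClosedForcingSet≤? c = Search.searchable-all? c

  allHaveClosedForcingSet≤-2v : AllHaveClosedForcingSet≤ (2 * v)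
  allHaveClosedForcingSet≤-2v M with hasClosedForcingSet≤-everything M
  ... | U , closed , forces , U≤v = U , closed , forces , ≤-trans U≤v (m≤n*m v 2)

  -- F(G) is the least k such that every perfect matching has a closed forcing set with at
  -- most 2k vertices; a matching without one for k - 1 attains it.
  maxForcingNumber : PerfectMatching G → ∃ (IsMaxForcingNumber G)
  maxForcingNumber M₀ with least (λ k → allHaveClosedForcingSet≤? (2 * k)) {v} allHaveClosedForcingSet≤-2v
  ... | k , all≤k , below = k , bounded , attained k below
    where
    bounded : (M : PerfectMatching G) → Σ (EdgeSet v) λ S → IsForcingSet M S × size S ≤ k
    bounded M with all≤k M
    ... | U , closed , forces , U≤2k =
      edgesOf M U closed , edgesOf-forcing M closed forces ,
      *-cancelˡ-≤ 2 (subst (_≤ 2 * k) (sym (2*size-edgesOf M closed)) U≤2k)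
    attained : ∀ k → (∀ j → j < k → ¬ AllHaveClosedForcingSet≤ (2 * j)) →
               Σ (PerfectMatching G) λ M → (S : EdgeSet v) → IsForcingSet M S → k ≤ size S
    attained zero    _     = M₀ , λ _ _ → z≤n
    attained (suc j) below with Search.searchable-¬∀⇒∃¬ (2 * j) (below j ≤-refl)
    ... | M , ¬has = M , λ S forcing → ≰⇒> λ S≤j →
      ¬has (verticesOf M S , verticesOf-closed M S , verticesOf-forcing M {S} forcing ,
            ≤-trans (count-verticesOf M {S} (proj₁ forcing)) (*-monoʳ-≤ 2 S≤j))

-- Forcing sets of a union of 4-cycles and single edges

EdgeIn : ∀ {v} → Fin v → Fin v → Comp v → Set
EdgeIn i j c = (i , j) ∈ compEdges c

module _ {v : ℕ} {a b c d x y : Fin v} where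

  C4∋ab : x ≡ a → y ≡ b → (x , y) ∈ compEdges (C4 a b c d)
  C4∋ab refl refl = here refl

  C4∋ba : x ≡ b → y ≡ a → (x , y) ∈ compEdges (C4 a b c d)
  C4∋ba refl refl = there (here refl)

  C4∋bc : x ≡ b → y ≡ c → (x , y) ∈ compEdges (C4 a b c d)
  C4∋bc refl refl = there (there (here refl))

  C4∋cb : x ≡ c → y ≡ b → (x , y) ∈ compEdges (C4 a b c d)
  C4∋cb refl refl = there (there (there (here refl)))

  C4∋cd : x ≡ c → y ≡ d → (x , y) ∈ compEdges (C4 a b c d)
  C4∋cd refl refl = there (there (there (there (here refl))))

  C4∋dc : x ≡ d → y ≡ c → (x , y) ∈ compEdges (C4 a b c d)
  C4∋dc refl refl = there (there (there (there (there (here refl)))))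

  C4∋da : x ≡ d → y ≡ a → (x , y) ∈ compEdges (C4 a b c d)
  C4∋da refl refl = there (there (there (there (there (there (here refl))))))

  C4∋ad : x ≡ a → y ≡ d → (x , y) ∈ compEdges (C4 a b c d)
  C4∋ad refl refl = there (there (there (there (there (there (there (here refl)))))))

module _ {v : ℕ} {a b x y : Fin v} where

  K2∋ab : x ≡ a → y ≡ b → (x , y) ∈ compEdges (K2 a b)
  K2∋ab refl refl = here refl

  K2∋ba : x ≡ b → y ≡ a → (x , y) ∈ compEdges (K2 a b)
  K2∋ba refl refl = there (here refl)

edge-source∈compVerts : ∀ {v} {x y : Fin v} (c : Comp v) → (x , y) ∈ compEdges c → x ∈ compVerts c
edge-source∈compVerts (C4 a b c d) (here refl) = here refl
edge-source∈compVerts (C4 a b c d) (there (here refl)) = there (here refl)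
edge-source∈compVerts (C4 a b c d) (there (there (here refl))) = there (here refl)
edge-source∈compVerts (C4 a b c d) (there (there (there (here refl)))) = there (there (here refl))
edge-source∈compVerts (C4 a b c d) (there (there (there (there (here refl))))) = there (there (here refl))
edge-source∈compVerts (C4 a b c d) (there (there (there (there (there (here refl)))))) =
  there (there (there (here refl)))
edge-source∈compVerts (C4 a b c d) (there (there (there (there (there (there (here refl))))))) =
  there (there (there (here refl)))
edge-source∈compVerts (C4 a b c d) (there (there (there (there (there (there (there (here refl)))))))) =
  here refl
edge-source∈compVerts (K2 a b) (here refl)         = here refl
edge-source∈compVerts (K2 a b) (there (here refl)) = there (here refl)

numC4-++ : ∀ {v} (cs ds : List (Comp v)) → numC4 (cs ++ ds) ≡ numC4 cs + numC4 ds
numC4-++ []                ds = refl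
numC4-++ (C4 _ _ _ _ ∷ cs) ds = cong suc (numC4-++ cs ds)
numC4-++ (K2 _ _ ∷ cs)     ds = numC4-++ cs ds

length-compVerts : ∀ {v} (cs : List (Comp v)) → length (concatMap compVerts cs) ≡ 4 * numC4 cs + 2 * numK2 cs
length-compVerts [] = refl
length-compVerts (C4 a b c d ∷ cs) =
  trans (cong (4 +_) (length-compVerts cs)) (cong (_+ 2 * numK2 cs) (sym (*-suc 4 (numC4 cs))))
length-compVerts (K2 a b ∷ cs) =
  trans (cong (2 +_) (length-compVerts cs))
        (sym (trans (cong (4 * numC4 cs +_) (*-suc 2 (numK2 cs)))
                    (trans (+-suc _ _) (cong suc (+-suc _ _)))))

numC4-concatMap : ∀ {v} {A : Set} (f : A → List (Comp v)) (xs : List A) →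
                  numC4 (concatMap f xs) ≡ List.sum (map (numC4 ∘ f) xs)
numC4-concatMap f []       = refl
numC4-concatMap f (x ∷ xs) = trans (numC4-++ (f x) (concatMap f xs)) (cong (numC4 (f x) +_) (numC4-concatMap f xs))

concatMap-concatMap : ∀ {A B C : Set} (f : B → List C) (g : A → List B) (xs : List A) →
                      concatMap f (concatMap g xs) ≡ concatMap (concatMap f ∘ g) xs
concatMap-concatMap f g []       = refl
concatMap-concatMap f g (x ∷ xs) =
  trans (concatMap-++ f (g x) (concatMap g xs)) (cong (concatMap f (g x) ++_) (concatMap-concatMap f g xs))

C4-rotate₂ : ∀ {v} {a b c d x y : Fin v} →
             (x , y) ∈ compEdges (C4 a b c d) → (x , y) ∈ compEdges (C4 c d a b)
C4-rotate₂ (here refl) = C4∋cd refl refl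
C4-rotate₂ (there (here refl)) = C4∋dc refl refl
C4-rotate₂ (there (there (here refl))) = C4∋da refl refl
C4-rotate₂ (there (there (there (here refl)))) = C4∋ad refl refl
C4-rotate₂ (there (there (there (there (here refl))))) = C4∋ab refl refl
C4-rotate₂ (there (there (there (there (there (here refl)))))) = C4∋ba refl refl
C4-rotate₂ (there (there (there (there (there (there (here refl))))))) = C4∋bc refl refl
C4-rotate₂ (there (there (there (there (there (there (there (here refl)))))))) = C4∋cb refl refl

C4-neighbours : ∀ {v} {a b c d y : Fin v} → a ≢ b → a ≢ c → a ≢ d →
                (a , y) ∈ compEdges (C4 a b c d) → y ≡ b ⊎ y ≡ d
C4-neighbours a≢b a≢c a≢d (here e) = inj₁ (cong proj₂ e)
C4-neighbours a≢b a≢c a≢d (there (here e)) = contradiction (cong proj₁ e) a≢b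
C4-neighbours a≢b a≢c a≢d (there (there (here e))) = contradiction (cong proj₁ e) a≢b
C4-neighbours a≢b a≢c a≢d (there (there (there (here e)))) = contradiction (cong proj₁ e) a≢c
C4-neighbours a≢b a≢c a≢d (there (there (there (there (here e))))) = contradiction (cong proj₁ e) a≢c
C4-neighbours a≢b a≢c a≢d (there (there (there (there (there (here e)))))) = contradiction (cong proj₁ e) a≢d
C4-neighbours a≢b a≢c a≢d (there (there (there (there (there (there (here e))))))) =
  contradiction (cong proj₁ e) a≢d
C4-neighbours a≢b a≢c a≢d (there (there (there (there (there (there (there (here e)))))))) =
  inj₂ (cong proj₂ e)

module _ {v : ℕ} (i j : Fin v) where

  transpose-left : transpose i j i ≡ j
  transpose-left rewrite dec-true (i ≟ i) refl = refl

  transpose-right : transpose i j j ≡ i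
  transpose-right with j ≟ i
  ... | yes j≡i = j≡i
  ... | no  _   rewrite dec-true (j ≟ j) refl = refl

  transpose-other : ∀ k → k ≢ i → k ≢ j → transpose i j k ≡ k
  transpose-other k k≢i k≢j rewrite dec-false (k ≟ i) k≢i | dec-false (k ≟ j) k≢j = refl

-- Conjugating m by the transposition (b d) trades the M-edges ab, cd for ad, bc.
module AlternatingSwap {v : ℕ} {G : Graph v} (M : PerfectMatching G) {a b c d : Fin v}
  (a≢d : a ≢ d) (b≢c : b ≢ c) (ma≡b : partner M a ≡ b) (mc≡d : partner M c ≡ d)
  (ad : adj G a d ≡ true) (bc : adj G b c ≡ true) where

  private
    m : Fin v → Fin v
    m = partner M
    τ τ⁻¹ : Fin v → Fin v
    τ   = transpose b d
    τ⁻¹ = transpose d b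

    a≢b : a ≢ b
    a≢b a≡b = noFix M a (trans ma≡b (sym a≡b))
    c≢d : c ≢ d
    c≢d c≡d = noFix M c (trans mc≡d (sym c≡d))
    mb≡a : m b ≡ a
    mb≡a = trans (cong m (sym ma≡b)) (invol M a)
    md≡c : m d ≡ c
    md≡c = trans (cong m (sym mc≡d)) (invol M c)

  swapped : Fin v → Fin v
  swapped x = τ (m (τ⁻¹ x))

  swapped-a : swapped a ≡ d
  swapped-a = trans (cong (τ ∘ m) (transpose-other d b a a≢d a≢b))
                    (trans (cong τ ma≡b) (transpose-left b d))

  swapped-b : swapped b ≡ c
  swapped-b = trans (cong (τ ∘ m) (transpose-right d b))
                    (trans (cong τ md≡c) (transpose-other b d c (b≢c ∘ sym) c≢d))

  swapped-c : swapped c ≡ b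
  swapped-c = trans (cong (τ ∘ m) (transpose-other d b c c≢d (b≢c ∘ sym)))
                    (trans (cong τ mc≡d) (transpose-right b d))

  swapped-d : swapped d ≡ a
  swapped-d = trans (cong (τ ∘ m) (transpose-left d b))
                    (trans (cong τ mb≡a) (transpose-other b d a a≢b a≢d))

  swapped-elsewhere : ∀ x → x ≢ a → x ≢ b → x ≢ c → x ≢ d → swapped x ≡ m x
  swapped-elsewhere x x≢a x≢b x≢c x≢d =
    trans (cong (τ ∘ m) (transpose-other d b x x≢d x≢b))
          (transpose-other b d (m x) (λ mx≡b → x≢a (trans (partner-swap M (sym mx≡b)) mb≡a))
                                     (λ mx≡d → x≢c (trans (partner-swap M (sym mx≡d)) md≡c)))

  private
    swapped-adj : ∀ x → Dec (x ≡ a) → Dec (x ≡ b) → Dec (x ≡ c) → Dec (x ≡ d) →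
                  adj G x (swapped x) ≡ true
    swapped-adj x (yes refl) _          _          _          = trans (cong (adj G x) swapped-a) ad
    swapped-adj x (no _)     (yes refl) _          _          = trans (cong (adj G x) swapped-b) bc
    swapped-adj x (no _)     (no _)     (yes refl) _          =
      trans (cong (adj G x) swapped-c) (trans (adj-sym G c b) bc)
    swapped-adj x (no _)     (no _)     (no _)     (yes refl) =
      trans (cong (adj G x) swapped-d) (trans (adj-sym G d a) ad)
    swapped-adj x (no x≢a)   (no x≢b)   (no x≢c)   (no x≢d)   =
      trans (cong (adj G x) (swapped-elsewhere x x≢a x≢b x≢c x≢d)) (inG M x)

  swappedMatching : PerfectMatching G
  swappedMatching = record
    { partner = swapped
    ; invol   = λ x → trans (cong (τ ∘ m) (transpose-inverse d b))
                            (trans (cong τ (invol M (τ⁻¹ x))) (transpose-inverse b d))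
    ; noFix   = λ x swapped-x≡x →
                  noFix M (τ⁻¹ x) (trans (sym (transpose-inverse d b)) (cong τ⁻¹ swapped-x≡x))
    ; inG     = λ x → swapped-adj x (x ≟ a) (x ≟ b) (x ≟ c) (x ≟ d)
    }

forcingSet-meets-alternating-C4 : ∀ {v} {G : Graph v} (M : PerfectMatching G) {V a b c d} →
  Closed M V → Forces M V → a ≢ d → b ≢ c → b ≢ d → partner M a ≡ b → partner M c ≡ d →
  adj G a d ≡ true → adj G b c ≡ true → V a ≡ true ⊎ V c ≡ true
forcingSet-meets-alternating-C4 M {V} {a} {b} {c} {d} closed forces a≢d b≢c b≢d ma≡b mc≡d ad bc
  with V a in Va | V c in Vc
... | true  | _     = inj₁ refl
... | false | true  = inj₂ refl
... | false | false =
  contradiction (trans (sym swapped-a) (trans (forces swappedMatching agree a) ma≡b)) (b≢d ∘ sym)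
  where
  open AlternatingSwap M a≢d b≢c ma≡b mc≡d ad bc
  Vb : V b ≡ false
  Vb = trans (cong V (sym ma≡b)) (trans (closed a) Va)
  Vd : V d ≡ false
  Vd = trans (cong V (sym mc≡d)) (trans (closed c) Vc)
  agree : AgreesOn M swappedMatching V
  agree x Vx = swapped-elsewhere x (true≢false-at Vx Va) (true≢false-at Vx Vb)
                                   (true≢false-at Vx Vc) (true≢false-at Vx Vd)

private
  unique-++ʳ : ∀ {A : Set} (xs : List A) {ys} → Unique (xs ++ ys) → Unique ys
  unique-++ʳ []       u       = u
  unique-++ʳ (x ∷ xs) (_ ∷ u) = unique-++ʳ xs u

  unique-++-disjoint : ∀ {A : Set} {x : A} (xs : List A) {ys} →
                       Unique (xs ++ ys) → x ∈ xs → x ∈ ys → ⊥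
  unique-++-disjoint (x ∷ xs) (x∉ ∷ _) (here refl)  x∈ys = All.lookup x∉ (++⁺ʳ xs x∈ys) refl
  unique-++-disjoint (_ ∷ xs) (_ ∷ u)  (there x∈xs) x∈ys = unique-++-disjoint xs u x∈xs x∈ys

module UnionLowerBound {v : ℕ} {G : Graph v} (M : PerfectMatching G)
  {V : Fin v → Bool} (closed : Closed M V) (forces : Forces M V) where

  weight : List (Fin v) → ℕ
  weight xs = List.sum (map (⟦_⟧ ∘ V) xs)

  Sound Local : List (Comp v) → Set
  Sound cs = ∀ {x y} → Any (EdgeIn x y) cs → adj G x y ≡ true
  Local cs = ∀ {x y} → x ∈ concatMap compVerts cs → adj G x y ≡ true → Any (EdgeIn x y) cs

  source∈vertices : ∀ {x y : Fin v} cs → Any (EdgeIn x y) cs → x ∈ concatMap compVerts cs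
  source∈vertices cs x~y with find x~y
  ... | c , c∈cs , x~y∈c = concatMap⁺ compVerts (lose c∈cs (edge-source∈compVerts c x~y∈c))

  local-head : ∀ {c cs} {x y : Fin v} → Unique (concatMap compVerts (c ∷ cs)) → Local (c ∷ cs) →
               x ∈ compVerts c → adj G x y ≡ true → (x , y) ∈ compEdges c
  local-head {c} {cs} u local x∈c xy with local (++⁺ˡ x∈c) xy
  ... | here  x~y = x~y
  ... | there x~y = ⊥-elim (unique-++-disjoint (compVerts c) u x∈c (source∈vertices cs x~y))

  local-tail : ∀ {c cs} → Unique (concatMap compVerts (c ∷ cs)) → Local (c ∷ cs) → Local cs
  local-tail {c} {cs} u local x∈cs xy with local (++⁺ʳ (compVerts c) x∈cs) xy
  ... | here  x~y = ⊥-elim (unique-++-disjoint (compVerts c) u (edge-source∈compVerts c x~y) x∈cs)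
  ... | there x~y = x~y

  private
    TwoOfFour : Bool → Bool → Bool → Bool → Set
    TwoOfFour p q r s =
      (p ≡ true × q ≡ true) ⊎ (r ≡ true × s ≡ true) ⊎
      (p ≡ true × s ≡ true) ⊎ (q ≡ true × r ≡ true)

    two-of-four : ∀ p q r s W → TwoOfFour p q r s →
                  2 + W ≤ ⟦ p ⟧ + (⟦ q ⟧ + (⟦ r ⟧ + (⟦ s ⟧ + W)))
    two-of-four .true .true r s W (inj₁ (refl , refl)) =
      +-monoʳ-≤ 2 (≤-trans (m≤n+m W ⟦ s ⟧) (m≤n+m _ ⟦ r ⟧))
    two-of-four p q .true .true W (inj₂ (inj₁ (refl , refl))) =
      ≤-trans (m≤n+m (2 + W) ⟦ q ⟧) (m≤n+m _ ⟦ p ⟧)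
    two-of-four .true q r .true W (inj₂ (inj₂ (inj₁ (refl , refl)))) =
      s≤s (≤-trans (m≤n+m (1 + W) ⟦ r ⟧) (m≤n+m _ ⟦ q ⟧))
    two-of-four p .true .true s W (inj₂ (inj₂ (inj₂ (refl , refl)))) =
      ≤-trans (s≤s (s≤s (m≤n+m W ⟦ s ⟧))) (m≤n+m _ ⟦ p ⟧)

  C4-weight : ∀ {a b c d} → a ≢ b → a ≢ c → b ≢ c → b ≢ d → c ≢ d → a ≢ d →
              (∀ {y} → adj G a y ≡ true → y ≡ b ⊎ y ≡ d) →
              (∀ {y} → adj G c y ≡ true → y ≡ d ⊎ y ≡ b) →
              adj G a b ≡ true → adj G b c ≡ true → adj G c d ≡ true → adj G d a ≡ true →
              ∀ W → 2 + W ≤ ⟦ V a ⟧ + (⟦ V b ⟧ + (⟦ V c ⟧ + (⟦ V d ⟧ + W)))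
  C4-weight {a} {b} {c} {d} a≢b a≢c b≢c b≢d c≢d a≢d neighbour-a neighbour-c ab bc cd da W
    with neighbour-a (inG M a) | neighbour-c (inG M c)
  ... | inj₁ ma≡b | inj₂ mc≡b = contradiction (partner-injective M (trans ma≡b (sym mc≡b))) a≢c
  ... | inj₂ ma≡d | inj₁ mc≡d = contradiction (partner-injective M (trans ma≡d (sym mc≡d))) a≢c
  ... | inj₁ ma≡b | inj₁ mc≡d =
    two-of-four (V a) (V b) (V c) (V d) W
      (case (forcingSet-meets-alternating-C4 M closed forces a≢d b≢c b≢d ma≡b mc≡d
                                             (trans (adj-sym G a d) da) bc))
    where
    case : V a ≡ true ⊎ V c ≡ true → TwoOfFour (V a) (V b) (V c) (V d)
    case (inj₁ Va) = inj₁ (Va , trans (cong V (sym ma≡b)) (trans (closed a) Va))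
    case (inj₂ Vc) = inj₂ (inj₁ (Vc , trans (cong V (sym mc≡d)) (trans (closed c) Vc)))
  ... | inj₂ ma≡d | inj₂ mc≡b =
    two-of-four (V a) (V b) (V c) (V d) W
      (case (forcingSet-meets-alternating-C4 M closed forces a≢b (c≢d ∘ sym) (b≢d ∘ sym) ma≡d mc≡b ab
                                             (trans (adj-sym G d c) cd)))
    where
    case : V a ≡ true ⊎ V c ≡ true → TwoOfFour (V a) (V b) (V c) (V d)
    case (inj₁ Va) = inj₂ (inj₂ (inj₁ (Va , trans (cong V (sym ma≡d)) (trans (closed a) Va))))
    case (inj₂ Vc) = inj₂ (inj₂ (inj₂ (trans (cong V (sym mc≡b)) (trans (closed c) Vc) , Vc)))

  weight-bound : ∀ cs → Unique (concatMap compVerts cs) → Sound cs → Local cs →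
                 2 * numC4 cs ≤ weight (concatMap compVerts cs)
  weight-bound [] _ _ _ = z≤n
  weight-bound (K2 a b ∷ cs) u sound local =
    ≤-trans (weight-bound cs (unique-++ʳ (a ∷ b ∷ []) u) (sound ∘ there) (local-tail u local))
            (≤-trans (m≤n+m _ ⟦ V b ⟧) (m≤n+m _ ⟦ V a ⟧))
  weight-bound (C4 a b c d ∷ cs)
               u@((a≢b ∷ a≢c ∷ a≢d ∷ _) ∷ (b≢c ∷ b≢d ∷ _) ∷ (c≢d ∷ _) ∷ _) sound local = begin
    2 * suc (numC4 cs)
      ≡⟨ *-suc 2 (numC4 cs) ⟩
    2 + 2 * numC4 cs
      ≤⟨ +-monoʳ-≤ 2 rest ⟩
    2 + W
      ≤⟨ C4-weight a≢b a≢c b≢c b≢d c≢d a≢d neighbour-a neighbour-c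
                   (edge (C4∋ab refl refl)) (edge (C4∋bc refl refl))
                   (edge (C4∋cd refl refl)) (edge (C4∋da refl refl)) W ⟩
    ⟦ V a ⟧ + (⟦ V b ⟧ + (⟦ V c ⟧ + (⟦ V d ⟧ + W))) ∎
    where
    open ≤-Reasoning
    W : ℕ
    W = weight (concatMap compVerts cs)
    rest : 2 * numC4 cs ≤ W
    rest = weight-bound cs (unique-++ʳ (a ∷ b ∷ c ∷ d ∷ []) u) (sound ∘ there) (local-tail u local)
    edge : ∀ {x y} → (x , y) ∈ compEdges (C4 a b c d) → adj G x y ≡ true
    edge = sound ∘ here
    neighbour-a : ∀ {y} → adj G a y ≡ true → y ≡ b ⊎ y ≡ d
    neighbour-a ay = C4-neighbours a≢b a≢c a≢d (local-head u local (here refl) ay)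
    neighbour-c : ∀ {y} → adj G c y ≡ true → y ≡ d ⊎ y ≡ b
    neighbour-c cy = C4-neighbours c≢d (a≢c ∘ sym) (b≢c ∘ sym)
                                   (C4-rotate₂ (local-head u local (there (there (here refl))) cy))

unionC4K2⇒C4s≤forcingSet : ∀ {v} {G : Graph v} {a b} → IsUnionC4K2 G a b →
                     (M : PerfectMatching G) (S : EdgeSet v) → IsForcingSet M S → a ≤ size S
unionC4K2⇒C4s≤forcingSet {v} {G} (cs , vertices↭ , adj⇔ , refl , _) M S forcing =
  *-cancelˡ-≤ 2 (begin
    2 * numC4 cs                                  ≤⟨ weight-bound cs unique sound local ⟩
    weight (concatMap compVerts cs)               ≡⟨ sum-↭ (map⁺ (⟦_⟧ ∘ V) vertices↭) ⟩
    weight (allFin v)                             ≡⟨ list-sum-allFin (⟦_⟧ ∘ V) ⟩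
    count V                                       ≤⟨ count-verticesOf M {S} (proj₁ forcing) ⟩
    2 * size S                                    ∎)
  where
  open ≤-Reasoning
  V : Fin v → Bool
  V = verticesOf M S
  open UnionLowerBound M (verticesOf-closed M S) (verticesOf-forcing M {S} forcing)
  unique : Unique (concatMap compVerts cs)
  unique = PermutationSetoid.Unique-resp-↭ (setoid (Fin v)) (↭⇒↭ₛ′ isEquivalence (↭-sym vertices↭))
                                           (allFin⁺ v)
  sound : Sound cs
  sound {x} {y} = from (adj⇔ x y)
  local : Local cs
  local {x} {y} _ = to (adj⇔ x y)

-- The edge bound, and the structure of G when it is attained

module MinimalForcingSet {v : ℕ} {G : Graph v} {M : PerfectMatching G} (minimum : MinimumClosedForcingSet M) where

  open MinimumClosedForcingSet minimum

  private
    m : Fin v → Fin v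
    m = partner M

    ∧-not-self : ∀ a c → a ∧ not a ∧ c ≡ false
    ∧-not-self a c = trans (sym (∧-assoc a (not a) c)) (cong (_∧ c) (∧-inverseʳ a))

  matchedPair⊆ : ∀ {u} → U u ≡ true → ∀ i → matchedPair M u i ≡ true → U i ≡ true
  matchedPair⊆ {u} Uu i i∈u with matchedPair-elim M {u} {i} i∈u
  ... | inj₁ refl = Uu
  ... | inj₂ refl = trans (closed u) Uu

  escape : ∀ {u} → U u ≡ true →
           ∃ λ M' → AgreesOn M M' (U ∖ matchedPair M u) × partner M' u ≢ m u × U (partner M' u) ≡ false
  escape {u} Uu with ¬Forces⇒counterexample M ¬forces
    where
    smaller : count (U ∖ matchedPair M u) < count U
    smaller = subst (count (U ∖ matchedPair M u) <_)
                (trans (cong (count (U ∖ matchedPair M u) +_) (sym (count-matchedPair M u)))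
                       (count-∖-⊆ U (matchedPair M u) (matchedPair⊆ Uu)))
                (m<m+n _ (s≤s z≤n))
    ¬forces : ¬ Forces M (U ∖ matchedPair M u)
    ¬forces forces′ = <⇒≱ smaller (minimal _ (closed-∖ M closed (closed-matchedPair M u)) forces′)
  ... | M' , agree , i , differ = M' , agree , moves , leaves
    where
    moves : partner M' u ≢ m u
    moves M'u≡mu = differ (forces M' agreeOnU i)
      where
      agreeOnU : AgreesOn M M' U
      agreeOnU j Uj with matchedPair M u j in j∈u
      ... | false = agree j (trans (cong (λ b → U j ∧ not b) j∈u) (cong (_∧ true) Uj))
      ... | true with matchedPair-elim M {u} {j} j∈u
      ...   | inj₁ refl = M'u≡mu
      ...   | inj₂ refl = trans (cong (partner M') (sym M'u≡mu)) (trans (invol M' u) (sym (invol M u)))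
    leaves : U (partner M' u) ≡ false
    leaves with U (partner M' u) in Uw
    ... | false = refl
    ... | true  = contradiction (partner-swap M (trans (sym (invol M' u)) (agree w w∈U∖u))) moves
      where
      w : Fin v
      w = partner M' u
      w∈U∖u : (U ∖ matchedPair M u) w ≡ true
      w∈U∖u rewrite dec-false (w ≟ u) (noFix M' u) | dec-false (w ≟ m u) moves | Uw = refl

  Crossing : Fin v → Fin v → Bool
  Crossing i j = U i ∧ not (U j) ∧ adj G i j

  ⟦Crossing⟧≡1 : ∀ {i j} → U i ≡ true → U j ≡ false → adj G i j ≡ true →
                 ⟦ Crossing i j ⟧ ≡ 1
  ⟦Crossing⟧≡1 Ui Uj ij rewrite Ui | Uj | ij = refl

  crossingDegree : Fin v → ℕ
  crossingDegree i = ∑[ j < v ] ⟦ Crossing i j ⟧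

  boundary : ℕ
  boundary = ∑[ i < v ] crossingDegree i

  ⟦U⟧≤crossingDegree : ∀ u → ⟦ U u ⟧ ≤ crossingDegree u
  ⟦U⟧≤crossingDegree u = exits (U u) refl
    where
    exits : ∀ b → U u ≡ b → ⟦ b ⟧ ≤ crossingDegree u
    exits false _  = z≤n
    exits true  Uu with escape Uu
    ... | M' , _ , _ , leaves = subst (_≤ crossingDegree u) (⟦Crossing⟧≡1 Uu leaves (inG M' u))
                                      (term≤sum (λ j → ⟦ Crossing u j ⟧) (partner M' u))

  count≤boundary : count U ≤ boundary
  count≤boundary = sum-mono-≤ ⟦U⟧≤crossingDegree

  matchedOrCrossing : Fin v → Fin v → ℕ
  matchedOrCrossing i j = ⟦ does (j ≟ m i) ⟧ + ⟦ Crossing i j ⟧ + ⟦ Crossing j i ⟧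

  matchedOrCrossing≤adj : ∀ i j → matchedOrCrossing i j ≤ ⟦ adj G i j ⟧
  matchedOrCrossing≤adj i j with j ≟ m i
  ... | yes refl rewrite closed i | ∧-not-self (U i) (adj G i (m i))
                       | ∧-not-self (U i) (adj G (m i) i) | inG M i = ≤-refl
  ... | no _ rewrite adj-sym G j i = one-way (U i) (U j) (adj G i j)
    where
    one-way : ∀ a b c → ⟦ a ∧ not b ∧ c ⟧ + ⟦ b ∧ not a ∧ c ⟧ ≤ ⟦ c ⟧
    one-way true  true  c     = z≤n
    one-way true  false true  = ≤-refl
    one-way true  false false = z≤n
    one-way false true  true  = ≤-refl
    one-way false true  false = z≤n
    one-way false false c     = z≤n

  sum-matchedOrCrossing : ∑[ i < v ] ∑[ j < v ] matchedOrCrossing i j ≡ v + 2 * boundary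
  sum-matchedOrCrossing = begin
    ∑[ i < v ] ∑[ j < v ] matchedOrCrossing i j
      ≡⟨ sum-cong-≗ (λ i → ∑-distrib-+ (λ j → ⟦ does (j ≟ m i) ⟧ + X i j) (λ j → X j i)) ⟩
    ∑[ i < v ] (∑[ j < v ] (⟦ does (j ≟ m i) ⟧ + X i j) + ∑[ j < v ] X j i)
      ≡⟨ sum-cong-≗ (λ i → cong (_+ ∑[ j < v ] X j i)
                               (trans (∑-distrib-+ (λ j → ⟦ does (j ≟ m i) ⟧) (X i))
                                      (cong (_+ ∑[ j < v ] X i j) (count-⁅⁆ (m i))))) ⟩
    ∑[ i < v ] ((1 + ∑[ j < v ] X i j) + ∑[ j < v ] X j i)
      ≡⟨ ∑-distrib-+ (λ i → 1 + ∑[ j < v ] X i j) (λ i → ∑[ j < v ] X j i) ⟩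
    ∑[ i < v ] (1 + ∑[ j < v ] X i j) + ∑[ i < v ] ∑[ j < v ] X j i
      ≡⟨ cong₂ _+_ (trans (∑-distrib-+ (λ _ → 1) (λ i → ∑[ j < v ] X i j))
                          (cong (_+ boundary) (count-true v)))
                   (sym (∑-comm (λ j i → X j i))) ⟩
    (v + boundary) + boundary
      ≡⟨ +-assoc v boundary boundary ⟩
    v + (boundary + boundary)
      ≡⟨ cong (λ b → v + (boundary + b)) (sym (+-identityʳ boundary)) ⟩
    v + 2 * boundary ∎
    where
    open ≡-Reasoning
    X : Fin v → Fin v → ℕ
    X i j = ⟦ Crossing i j ⟧

  2*e≡sum-adj : 2 * e G ≡ ∑[ i < v ] ∑[ j < v ] ⟦ adj G i j ⟧
  2*e≡sum-adj = sym (handshake (adj G) (adj-irrefl G) (adj-sym G))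

  matching+boundary≤edges : v + 2 * boundary ≤ 2 * e G
  matching+boundary≤edges = begin
    v + 2 * boundary                                ≡⟨ sym sum-matchedOrCrossing ⟩
    ∑[ i < v ] ∑[ j < v ] matchedOrCrossing i j     ≤⟨ sum-mono-≤ (sum-mono-≤ ∘ matchedOrCrossing≤adj) ⟩
    ∑[ i < v ] ∑[ j < v ] ⟦ adj G i j ⟧             ≡⟨ sym 2*e≡sum-adj ⟩
    2 * e G                                         ∎
    where open ≤-Reasoning

  matching+forcingSet≤edges : v + 2 * count U ≤ 2 * e G
  matching+forcingSet≤edges = ≤-trans (+-monoʳ-≤ v (*-monoʳ-≤ 2 count≤boundary)) matching+boundary≤edges

  module Tight (tight : 2 * e G ≤ v + 2 * count U) where

    boundary≤count : boundary ≤ count U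
    boundary≤count = *-cancelˡ-≤ 2 (+-cancelˡ-≤ v _ _ (≤-trans matching+boundary≤edges tight))

    crossingDegree≤⟦U⟧ : ∀ u → crossingDegree u ≤ ⟦ U u ⟧
    crossingDegree≤⟦U⟧ = sum-rigid ⟦U⟧≤crossingDegree boundary≤count

    adj≤matchedOrCrossing : ∀ i j → ⟦ adj G i j ⟧ ≤ matchedOrCrossing i j
    adj≤matchedOrCrossing i = sum-rigid (matchedOrCrossing≤adj i) (rows i)
      where
      total : ∑[ i < v ] ∑[ j < v ] ⟦ adj G i j ⟧ ≤ ∑[ i < v ] ∑[ j < v ] matchedOrCrossing i j
      total = begin
        ∑[ i < v ] ∑[ j < v ] ⟦ adj G i j ⟧          ≡⟨ sym 2*e≡sum-adj ⟩
        2 * e G                                      ≤⟨ tight ⟩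
        v + 2 * count U                              ≤⟨ +-monoʳ-≤ v (*-monoʳ-≤ 2 count≤boundary) ⟩
        v + 2 * boundary                             ≡⟨ sym sum-matchedOrCrossing ⟩
        ∑[ i < v ] ∑[ j < v ] matchedOrCrossing i j  ∎
        where open ≤-Reasoning
      rows : ∀ i → ∑[ j < v ] ⟦ adj G i j ⟧ ≤ ∑[ j < v ] matchedOrCrossing i j
      rows = sum-rigid (λ i → sum-mono-≤ (matchedOrCrossing≤adj i)) total

    unmatched-edge-crosses : ∀ {i j} → adj G i j ≡ true → j ≢ m i → U j ≡ not (U i)
    unmatched-edge-crosses {i} {j} ij j≢mi = crosses (U i) (U j) bound
      where
      bound : 1 ≤ ⟦ U i ∧ not (U j) ∧ true ⟧ + ⟦ U j ∧ not (U i) ∧ true ⟧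
      bound with adj≤matchedOrCrossing i j
      ... | b rewrite ij | adj-sym G j i | ij | dec-false (j ≟ m i) j≢mi = b
      crosses : ∀ a b → 1 ≤ ⟦ a ∧ not b ∧ true ⟧ + ⟦ b ∧ not a ∧ true ⟧ → b ≡ not a
      crosses true  false _ = refl
      crosses false true  _ = refl
      crosses true  true  ()
      crosses false false ()

    exit-unique : ∀ {u j j'} → U u ≡ true → adj G u j ≡ true → U j ≡ false →
                  adj G u j' ≡ true → U j' ≡ false → j ≡ j'
    exit-unique {u} {j} {j'} Uu uj Uj uj' Uj' with j ≟ j'
    ... | yes j≡j' = j≡j'
    ... | no  j≢j' = contradiction two≤one λ { (s≤s ()) }
      where
      two≤one : 2 ≤ 1
      two≤one = begin
        2                                     ≡⟨ cong₂ _+_ (⟦Crossing⟧≡1 Uu Uj uj)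
                                                           (⟦Crossing⟧≡1 Uu Uj' uj') ⟨
        ⟦ Crossing u j ⟧ + ⟦ Crossing u j' ⟧  ≤⟨ two-terms≤sum (λ k → ⟦ Crossing u k ⟧) j≢j' ⟩
        crossingDegree u                      ≤⟨ crossingDegree≤⟦U⟧ u ⟩
        ⟦ U u ⟧                               ≡⟨ cong ⟦_⟧ Uu ⟩
        1                                     ∎
        where open ≤-Reasoning

    private
      exit? : ∀ u → Dec (∃ λ j → adj G u j ≡ true × U j ≡ false)
      exit? u = any? (λ j → (adj G u j ≟ᵇ true) ×-dec (U j ≟ᵇ false))

      chosenOr : ∀ {u} → Fin v → Dec (∃ λ j → adj G u j ≡ true × U j ≡ false) → Fin v
      chosenOr _ (yes (j , _)) = j
      chosenOr u (no _)        = u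

    -- The unique neighbour of u ∈ U outside U (junk value u for u ∉ U).
    exit : Fin v → Fin v
    exit u = chosenOr u (exit? u)

    exit-spec : ∀ {u} → U u ≡ true → adj G u (exit u) ≡ true × U (exit u) ≡ false
    exit-spec {u} Uu with exit? u
    ... | yes (_ , spec) = spec
    ... | no none with escape Uu
    ...   | M' , _ , _ , leaves = contradiction (partner M' u , inG M' u , leaves) none

    exit-adj : ∀ {u} → U u ≡ true → adj G u (exit u) ≡ true
    exit-adj = proj₁ ∘ exit-spec

    exit-outside : ∀ {u} → U u ≡ true → U (exit u) ≡ false
    exit-outside = proj₂ ∘ exit-spec

    ≡exit : ∀ {u j} → U u ≡ true → adj G u j ≡ true → U j ≡ false → j ≡ exit u
    ≡exit Uu uj Uj = exit-unique Uu uj Uj (exit-adj Uu) (exit-outside Uu)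

    neighbours-of-U : ∀ {u j} → U u ≡ true → adj G u j ≡ true → j ≡ m u ⊎ j ≡ exit u
    neighbours-of-U {u} {j} Uu uj with j ≟ m u
    ... | yes j≡mu = inj₁ j≡mu
    ... | no  j≢mu = inj₂ (≡exit Uu uj (trans (unmatched-edge-crosses uj j≢mu) (cong not Uu)))

    -- The matching escaping at u sends m(exit u) into U, and m u is the only vertex of U it can reach.
    partner-exit-adjacent : ∀ {u} → U u ≡ true → adj G (m u) (m (exit u)) ≡ true
    partner-exit-adjacent {u} Uu with escape Uu
    ... | M' , agree , moves , leaves =
      subst₂ (λ a b → adj G a (m b) ≡ true) q≡mu (≡exit Uu (inG M' u) leaves)
             (trans (adj-sym G q z) (inG M' z))
      where
      w z q : Fin v
      w = partner M' u
      z = m w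
      q = partner M' z
      Uz : U z ≡ false
      Uz = trans (closed w) leaves
      q≢w : q ≢ w
      q≢w q≡w = true≢false-at {P = U} Uu Uz (sym (partner-injective M' q≡w))
      Uq : U q ≡ true
      Uq = trans (unmatched-edge-crosses (inG M' z) (q≢w ∘ λ q≡mz → trans q≡mz (invol M w))) (cong not Uz)
      q≡mu : q ≡ m u
      q≡mu with matchedPair M u q in q∈u
      ... | false = contradiction (trans (partner-swap M (trans (sym (invol M' z)) (agree q q∈U∖u)))
                                         (invol M w)) q≢w
        where
        q∈U∖u : (U ∖ matchedPair M u) q ≡ true
        q∈U∖u = trans (cong (λ b → U q ∧ not b) q∈u) (cong (_∧ true) Uq)
      ... | true with matchedPair-elim M {u} {q} q∈u
      ...   | inj₂ q≡mu = q≡mu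
      ...   | inj₁ q≡u  = contradiction (trans (cong (partner M') (sym q≡u)) (invol M' z)) (noFix M w ∘ sym)

    exit-partner : ∀ {u} → U u ≡ true → exit (m u) ≡ m (exit u)
    exit-partner {u} Uu = sym (≡exit (trans (closed u) Uu) (partner-exit-adjacent Uu)
                                     (trans (closed (exit u)) (exit-outside Uu)))

    stays-if-exit-fixed : ∀ {a x} (M' : PerfectMatching G) → U a ≡ true → partner M' x ≡ m x →
                          exit a ≡ x ⊎ exit a ≡ m x → partner M' a ≡ m a
    stays-if-exit-fixed {a} {x} M' Ua M'x≡mx exit-a with neighbours-of-U Ua (inG M' a)
    ... | inj₁ M'a≡ma = M'a≡ma
    ... | inj₂ M'a≡exit with exit-a
    ...   | inj₁ exit≡x  =
      contradiction (trans (sym (invol M' a)) (trans (cong (partner M') (trans M'a≡exit exit≡x)) M'x≡mx))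
                    (true≢false-at {P = U} Ua
                       (trans (closed x) (subst (λ y → U y ≡ false) exit≡x (exit-outside Ua))))
    ...   | inj₂ exit≡mx =
      contradiction (trans (sym (invol M' a)) (trans (cong (partner M') (trans M'a≡exit exit≡mx))
                                                     (trans (cong (partner M') (sym M'x≡mx)) (invol M' x))))
                    (true≢false-at {P = U} Ua
                       (trans (sym (closed x)) (subst (λ y → U y ≡ false) exit≡mx (exit-outside Ua))))

    pinned-by-exit : ∀ {u x} (M' : PerfectMatching G) → U u ≡ true → exit u ≡ x → partner M' x ≡ m x →
                     AgreesOn M M' (matchedPair M u)
    pinned-by-exit {u} M' Uu exit≡x M'x≡mx j j∈u with matchedPair-elim M {u} {j} j∈u
    ... | inj₁ refl = stays-if-exit-fixed M' Uu M'x≡mx (inj₁ exit≡x)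
    ... | inj₂ refl = stays-if-exit-fixed M' (trans (closed u) Uu) M'x≡mx
                                          (inj₂ (trans (exit-partner Uu) (cong m exit≡x)))

    -- Replacing the M-edges at two U-neighbours u, t of x by the M-edge at x leaves a forcing set.
    module _ {x u t} (Ux : U x ≡ false) (Uu : U u ≡ true) (Ut : U t ≡ true)
             (ux : adj G u x ≡ true) (tx : adj G t x ≡ true) where

      traded : Fin v → Bool
      traded = (U ∖ (matchedPair M u ∪ matchedPair M t)) ∪ matchedPair M x

      traded-closed : Closed M traded
      traded-closed =
        closed-∪ M (closed-∖ M closed (closed-∪ M (closed-matchedPair M u) (closed-matchedPair M t)))
                   (closed-matchedPair M x)

      traded-forces : Forces M traded
      traded-forces M' agree = forces M' agreeOnU
        where
        M'x≡mx : partner M' x ≡ m x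
        M'x≡mx = agree x (trans (cong ((U ∖ (matchedPair M u ∪ matchedPair M t)) x ∨_) (matchedPair-self M x))
                                (∨-zeroʳ _))
        agreeOnU : AgreesOn M M' U
        agreeOnU j Uj with matchedPair M u j in j∈u | matchedPair M t j in j∈t
        ... | true  | _     = pinned-by-exit M' Uu (sym (≡exit Uu ux Ux)) M'x≡mx j j∈u
        ... | false | true  = pinned-by-exit M' Ut (sym (≡exit Ut tx Ux)) M'x≡mx j j∈t
        ... | false | false = agree j (cong (_∨ matchedPair M x j)
                                            (trans (cong (λ b → U j ∧ not b) (cong₂ _∨_ j∈u j∈t))
                                                   (cong (_∧ true) Uj)))

      traded-smaller : t ≢ u → t ≢ m u → count traded < count U
      traded-smaller t≢u t≢mu = begin-strict
        count traded                              ≤⟨ count-∪≤ (U ∖ P) (matchedPair M x) ⟩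
        count (U ∖ P) + count (matchedPair M x)   ≡⟨ cong (count (U ∖ P) +_) (count-matchedPair M x) ⟩
        count (U ∖ P) + 2                         <⟨ +-monoʳ-< (count (U ∖ P)) (s≤s (s≤s (s≤s z≤n))) ⟩
        count (U ∖ P) + 4                         ≡⟨ cong (count (U ∖ P) +_) count-P ⟨
        count (U ∖ P) + count P                   ≡⟨ count-∖-⊆ U P P⊆U ⟩
        count U                                   ∎
        where
        open ≤-Reasoning
        P : Fin v → Bool
        P = matchedPair M u ∪ matchedPair M t
        P⊆U : ∀ i → P i ≡ true → U i ≡ true
        P⊆U i i∈P with matchedPair M u i in i∈u
        ... | true  = matchedPair⊆ Uu i i∈u
        ... | false = matchedPair⊆ Ut i i∈P
        disjoint : ∀ i → (matchedPair M u ∩ matchedPair M t) i ≡ false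
        disjoint i with matchedPair M u i in i∈u | matchedPair M t i in i∈t
        ... | false | _     = refl
        ... | true  | false = refl
        ... | true  | true  with matchedPair-elim M {u} {i} i∈u | matchedPair-elim M {t} {i} i∈t
        ...   | inj₁ i≡u  | inj₁ i≡t  = contradiction (trans (sym i≡t) i≡u) t≢u
        ...   | inj₁ i≡u  | inj₂ i≡mt = contradiction (partner-swap M (trans (sym i≡u) i≡mt)) t≢mu
        ...   | inj₂ i≡mu | inj₁ i≡t  = contradiction (trans (sym i≡t) i≡mu) t≢mu
        ...   | inj₂ i≡mu | inj₂ i≡mt = contradiction (partner-injective M (trans (sym i≡mt) i≡mu)) t≢u
        count-P : count P ≡ 4
        count-P = trans (count-∪-disjoint (matchedPair M u) (matchedPair M t) disjoint)
                        (cong₂ _+_ (count-matchedPair M u) (count-matchedPair M t))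

    U-neighbour-unique : ∀ {x u t} → U x ≡ false → U u ≡ true → U t ≡ true →
                         adj G u x ≡ true → adj G t x ≡ true → t ≡ u
    U-neighbour-unique {x} {u} {t} Ux Uu Ut ux tx with t ≟ u
    ... | yes t≡u = t≡u
    ... | no  t≢u with t ≟ m u
    ...   | yes t≡mu = contradiction (trans (≡exit Ut tx Ux) (trans (cong exit t≡mu)
                                       (trans (exit-partner Uu) (cong m (sym (≡exit Uu ux Ux))))))
                                     (noFix M x ∘ sym)
    ...   | no  t≢mu = contradiction (minimal _ (traded-closed Ux Uu Ut ux tx) (traded-forces Ux Uu Ut ux tx))
                                     (<⇒≱ (traded-smaller Ux Uu Ut ux tx t≢u t≢mu))

    -- Each component is listed once, at the lower end (lead) of one of its M-edges: vertices of U
    -- and isolated M-edges at their own M-edge, other vertices at that of their U-neighbour (anchor).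
    lead : Fin v → Fin v
    lead a = if a ≺ m a then a else m a

    lead-partner : ∀ a → lead (m a) ≡ lead a
    lead-partner a with a ≺ m a in a≺ma
    ... | true  rewrite invol M a | ≺-flip (noFix M a ∘ sym) | a≺ma = refl
    ... | false rewrite invol M a | ≺-flip (noFix M a ∘ sym) | a≺ma = refl

    lead-self : ∀ {a} → (a ≺ m a) ≡ true → lead a ≡ a
    lead-self a≺ma rewrite a≺ma = refl

    lead-≺ : ∀ a → (lead a ≺ m (lead a)) ≡ true
    lead-≺ a with a ≺ m a in a≺ma
    ... | true  = a≺ma
    ... | false rewrite invol M a | ≺-flip (noFix M a ∘ sym) | a≺ma = refl

    lead-cases : ∀ a → lead a ≡ a ⊎ lead a ≡ m a
    lead-cases a with a ≺ m a
    ... | true  = inj₁ refl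
    ... | false = inj₂ refl

    HasUNeighbour : Fin v → Set
    HasUNeighbour x = ∃ λ s → adj G x s ≡ true × U s ≡ true

    private
      uNeighbour? : ∀ x → Dec (HasUNeighbour x)
      uNeighbour? x = any? (λ s → (adj G x s ≟ᵇ true) ×-dec (U s ≟ᵇ true))

      anchorCase : ∀ {x} → Bool → Dec (HasUNeighbour x) → Fin v
      anchorCase {x} true  _              = x
      anchorCase {x} false (yes (s , _)) = s
      anchorCase {x} false (no _)        = x

    anchor : Fin v → Fin v
    anchor x = anchorCase (U x) (uNeighbour? x)

    leader : Fin v → Fin v
    leader x = lead (anchor x)

    anchor-inside : ∀ {x} → U x ≡ true → anchor x ≡ x
    anchor-inside Ux rewrite Ux = refl

    anchor-neighbour : ∀ {x s} → U x ≡ false → adj G x s ≡ true → U s ≡ true → anchor x ≡ s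
    anchor-neighbour {x} {s} Ux xs Us rewrite Ux with uNeighbour? x
    ... | yes (s' , xs' , Us') = U-neighbour-unique Ux Us Us' (trans (adj-sym G s x) xs) (trans (adj-sym G s' x) xs')
    ... | no none = contradiction (s , xs , Us) none

    anchor-isolated : ∀ {x} → U x ≡ false → ¬ HasUNeighbour x → anchor x ≡ x
    anchor-isolated {x} Ux isolated rewrite Ux with uNeighbour? x
    ... | yes found = contradiction found isolated
    ... | no _ = refl

    isolated-partner : ∀ {a} → U a ≡ false → ¬ HasUNeighbour a → ¬ HasUNeighbour (m a)
    isolated-partner {a} Ua isolated (s , mas , Us) = isolated (m s , a~ms , trans (closed s) Us)
      where
      ma≡exit : m a ≡ exit s
      ma≡exit = ≡exit Us (trans (adj-sym G s (m a)) mas) (trans (closed a) Ua)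
      exit-ms≡a : exit (m s) ≡ a
      exit-ms≡a = trans (exit-partner Us) (trans (cong m (sym ma≡exit)) (invol M a))
      a~ms : adj G a (m s) ≡ true
      a~ms = trans (adj-sym G a (m s))
                   (subst (λ y → adj G (m s) y ≡ true) exit-ms≡a (exit-adj (trans (closed s) Us)))

    private
      componentCase : Fin v → Bool → Bool → Bool → List (Comp v)
      componentCase a true true  _    = C4 a (m a) (m (exit a)) (exit a) ∷ []
      componentCase a true false true = K2 a (m a) ∷ []
      componentCase a _    _     _    = []

    componentAt : Fin v → List (Comp v)
    componentAt a = componentCase a (a ≺ m a) (U a) (not (does (uNeighbour? a)))

    verticesAt : Fin v → List (Fin v)
    verticesAt a = concatMap compVerts (componentAt a)

    leader-verticesAt : ∀ a {x} → x ∈ verticesAt a → leader x ≡ a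
    leader-verticesAt a x∈ with a ≺ m a in a≺ma | U a in Ua | uNeighbour? a
    leader-verticesAt a (here refl) | true | true | _ =
      trans (cong lead (anchor-inside Ua)) (lead-self a≺ma)
    leader-verticesAt a (there (here refl)) | true | true | _ =
      trans (cong lead (anchor-inside (trans (closed a) Ua))) (trans (lead-partner a) (lead-self a≺ma))
    leader-verticesAt a (there (there (here refl))) | true | true | _ =
      trans (cong lead (anchor-neighbour (trans (closed (exit a)) (exit-outside Ua))
                                         (trans (adj-sym G (m (exit a)) (m a)) (partner-exit-adjacent Ua))
                                         (trans (closed a) Ua)))
            (trans (lead-partner a) (lead-self a≺ma))
    leader-verticesAt a (there (there (there (here refl)))) | true | true | _ =
      trans (cong lead (anchor-neighbour (exit-outside Ua) (trans (adj-sym G (exit a) a) (exit-adj Ua)) Ua))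
            (lead-self a≺ma)
    leader-verticesAt a (here refl) | true | false | no isolated =
      trans (cong lead (anchor-isolated Ua isolated)) (lead-self a≺ma)
    leader-verticesAt a (there (here refl)) | true | false | no isolated =
      trans (cong lead (anchor-isolated (trans (closed a) Ua) (isolated-partner Ua isolated)))
            (trans (lead-partner a) (lead-self a≺ma))

    verticesAt-unique : ∀ a → Unique (verticesAt a)
    verticesAt-unique a with a ≺ m a | U a in Ua | uNeighbour? a
    ... | true | true | _ =
      (a≢ma ∷ true≢false-at {P = U} Ua Ume ∷ true≢false-at {P = U} Ua Ue ∷ []) ∷
      (true≢false-at {P = U} Uma Ume ∷ true≢false-at {P = U} Uma Ue ∷ []) ∷
      (noFix M (exit a) ∷ []) ∷ [] ∷ []
      where
      a≢ma : a ≢ m a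
      a≢ma = noFix M a ∘ sym
      Uma : U (m a) ≡ true
      Uma = trans (closed a) Ua
      Ue : U (exit a) ≡ false
      Ue = exit-outside Ua
      Ume : U (m (exit a)) ≡ false
      Ume = trans (closed (exit a)) Ue
    ... | true  | false | no _  = ((noFix M a ∘ sym) ∷ []) ∷ [] ∷ []
    ... | true  | false | yes _ = []
    ... | false | _     | _     = []

    componentAt-edges : ∀ a {i j} → Any (EdgeIn i j) (componentAt a) → adj G i j ≡ true
    componentAt-edges a i~j with a ≺ m a | U a in Ua | uNeighbour? a
    componentAt-edges a (here (here refl)) | true | true | _ = inG M a
    componentAt-edges a (here (there (here refl))) | true | true | _ = trans (adj-sym G (m a) a) (inG M a)
    componentAt-edges a (here (there (there (here refl)))) | true | true | _ = partner-exit-adjacent Ua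
    componentAt-edges a (here (there (there (there (here refl))))) | true | true | _ =
      trans (adj-sym G (m (exit a)) (m a)) (partner-exit-adjacent Ua)
    componentAt-edges a (here (there (there (there (there (here refl)))))) | true | true | _ =
      subst (λ y → adj G (m (exit a)) y ≡ true) (invol M (exit a)) (inG M (m (exit a)))
    componentAt-edges a (here (there (there (there (there (there (here refl))))))) | true | true | _ = inG M (exit a)
    componentAt-edges a (here (there (there (there (there (there (there (here refl)))))))) | true | true | _ =
      trans (adj-sym G (exit a) a) (exit-adj Ua)
    componentAt-edges a (here (there (there (there (there (there (there (there (here refl))))))))) | true | true | _ =
      exit-adj Ua
    componentAt-edges a (here (here refl)) | true | false | no _ = inG M a
    componentAt-edges a (here (there (here refl))) | true | false | no _ = trans (adj-sym G (m a) a) (inG M a)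

    numC4-componentAt : ∀ a → numC4 (componentAt a) ≡ ⟦ a ≺ m a ∧ U a ⟧
    numC4-componentAt a with a ≺ m a | U a | uNeighbour? a
    ... | true  | true  | _     = refl
    ... | true  | false | no _  = refl
    ... | true  | false | yes _ = refl
    ... | false | _     | _     = refl

    U-lead : ∀ a → U (lead a) ≡ U a
    U-lead a with lead-cases a
    ... | inj₁ lead≡a  = cong U lead≡a
    ... | inj₂ lead≡ma = trans (cong U lead≡ma) (closed a)

    components : List (Comp v)
    components = concatMap componentAt (allFin v)

    ∈components : ∀ {a} {P : Comp v → Set} → Any P (componentAt a) → Any P components
    ∈components {a} = concatMap⁺ componentAt ∘ lose (∈-allFin a)

    private
      C4-at : ∀ {b i j} → U b ≡ true →
              (i , j) ∈ compEdges (C4 (lead b) (m (lead b)) (m (exit (lead b))) (exit (lead b))) →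
              Any (EdgeIn i j) components
      C4-at {b} Ub ij = ∈components (subst (Any (EdgeIn _ _)) (sym componentAt≡) (here ij))
        where
        componentAt≡ : componentAt (lead b) ≡ C4 (lead b) (m (lead b)) (m (exit (lead b))) (exit (lead b)) ∷ []
        componentAt≡ rewrite lead-≺ b | U-lead b | Ub = refl

      K2-at : ∀ {b i j} → U b ≡ false → ¬ HasUNeighbour b →
              (i , j) ∈ compEdges (K2 (lead b) (m (lead b))) → Any (EdgeIn i j) components
      K2-at {b} Ub isolated ij = ∈components (subst (Any (EdgeIn _ _)) (sym componentAt≡) (here ij))
        where
        lead-isolated : ¬ HasUNeighbour (lead b)
        lead-isolated with lead-cases b
        ... | inj₁ lead≡b  = subst (λ y → ¬ HasUNeighbour y) (sym lead≡b) isolated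
        ... | inj₂ lead≡mb = subst (λ y → ¬ HasUNeighbour y) (sym lead≡mb) (isolated-partner Ub isolated)
        componentAt≡ : componentAt (lead b) ≡ K2 (lead b) (m (lead b)) ∷ []
        componentAt≡ rewrite lead-≺ b | U-lead b | Ub with uNeighbour? (lead b)
        ... | yes found = contradiction found lead-isolated
        ... | no _ = refl

    matched-edge∈components : ∀ i → Any (EdgeIn i (m i)) components
    matched-edge∈components i with U i in Ui
    ... | true with lead-cases i
    ...   | inj₁ lead≡i  = C4-at Ui (C4∋ab (sym lead≡i) (cong m (sym lead≡i)))
    ...   | inj₂ lead≡mi = C4-at Ui (C4∋ba (partner-swap M lead≡mi) (sym lead≡mi))
    matched-edge∈components i | false with uNeighbour? i
    ... | yes (s , is , Us) with lead-cases s
    ...   | inj₁ lead≡s  = C4-at Us (C4∋dc i≡exit-lead (cong m i≡exit-lead))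
      where
      i≡exit-lead : i ≡ exit (lead s)
      i≡exit-lead = trans (≡exit Us (trans (adj-sym G s i) is) Ui) (cong exit (sym lead≡s))
    ...   | inj₂ lead≡ms = C4-at Us (C4∋cd i≡m-exit-lead (trans (cong m i≡m-exit-lead) (invol M _)))
      where
      i≡m-exit-lead : i ≡ m (exit (lead s))
      i≡m-exit-lead = trans (≡exit Us (trans (adj-sym G s i) is) Ui)
                            (trans (cong exit (partner-swap M lead≡ms)) (exit-partner (trans (U-lead s) Us)))
    matched-edge∈components i | false | no isolated with lead-cases i
    ...   | inj₁ lead≡i  = K2-at Ui isolated (K2∋ab (sym lead≡i) (cong m (sym lead≡i)))
    ...   | inj₂ lead≡mi = K2-at Ui isolated (K2∋ba (partner-swap M lead≡mi) (sym lead≡mi))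

    private
      exit-lead : ∀ {u} → U u ≡ true → lead u ≡ m u → exit u ≡ m (exit (lead u))
      exit-lead {u} Uu lead≡mu = trans (cong exit (partner-swap M lead≡mu)) (exit-partner (trans (U-lead u) Uu))

    exit-edge∈components : ∀ {u} → U u ≡ true → Any (EdgeIn u (exit u)) components
    exit-edge∈components {u} Uu with lead-cases u
    ... | inj₁ lead≡u  = C4-at Uu (C4∋ad (sym lead≡u) (cong exit (sym lead≡u)))
    ... | inj₂ lead≡mu = C4-at Uu (C4∋bc (partner-swap M lead≡mu) (exit-lead Uu lead≡mu))

    exit-edge∈components′ : ∀ {u} → U u ≡ true → Any (EdgeIn (exit u) u) components
    exit-edge∈components′ {u} Uu with lead-cases u
    ... | inj₁ lead≡u  = C4-at Uu (C4∋da (cong exit (sym lead≡u)) (sym lead≡u))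
    ... | inj₂ lead≡mu = C4-at Uu (C4∋cb (exit-lead Uu lead≡mu) (partner-swap M lead≡mu))

    adj⇒∈components : ∀ {i j} → adj G i j ≡ true → Any (EdgeIn i j) components
    adj⇒∈components {i} {j} ij with j ≟ m i
    ... | yes j≡mi = subst (λ y → Any (EdgeIn i y) components) (sym j≡mi) (matched-edge∈components i)
    ... | no  j≢mi with U i in Ui
    ...   | true  = subst (λ y → Any (EdgeIn i y) components)
                          (sym (≡exit Ui ij (trans (unmatched-edge-crosses ij j≢mi) (cong not Ui))))
                          (exit-edge∈components Ui)
    ...   | false = subst (λ y → Any (EdgeIn y j) components)
                          (sym (≡exit Uj (trans (adj-sym G j i) ij) Ui))
                          (exit-edge∈components′ Uj)
      where
      Uj : U j ≡ true
      Uj = trans (unmatched-edge-crosses ij j≢mi) (cong not Ui)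

    ∈components⇒adj : ∀ {i j} → Any (EdgeIn i j) components → adj G i j ≡ true
    ∈components⇒adj i~j with find (concatMap⁻ componentAt {xs = allFin v} i~j)
    ... | a , _ , i~j∈a = componentAt-edges a i~j∈a

    vertices-unique : Unique (concatMap compVerts components)
    vertices-unique = subst Unique (sym (concatMap-concatMap compVerts componentAt (allFin v)))
                            (concat⁺ (All.map⁺ (All.universal verticesAt-unique (allFin v)))
                                     (AllPairs.map⁺ (AllPairs.map disjoint (allFin⁺ v))))
      where
      disjoint : ∀ {a b} → a ≢ b → Disjoint (verticesAt a) (verticesAt b)
      disjoint a≢b (x∈a , x∈b) = a≢b (trans (sym (leader-verticesAt _ x∈a)) (leader-verticesAt _ x∈b))

    vertices-complete : ∀ x → x ∈ concatMap compVerts components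
    vertices-complete x with find (matched-edge∈components x)
    ... | c , c∈ , x~mx = concatMap⁺ compVerts (lose c∈ (edge-source∈compVerts c x~mx))

    vertices↭ : concatMap compVerts components ↭ allFin v
    vertices↭ = ∼bag⇒↭ (unique∧set⇒bag vertices-unique (allFin⁺ v)
                          (λ {x} → mk⇔ (λ _ → ∈-allFin x) (λ _ → vertices-complete x)))

    numC4-components : numC4 components ≡ size (edgesOf M U closed)
    numC4-components = begin
      numC4 components                                ≡⟨ numC4-concatMap componentAt (allFin v) ⟩
      List.sum (map (numC4 ∘ componentAt) (allFin v)) ≡⟨ list-sum-allFin (numC4 ∘ componentAt) ⟩
      ∑[ a < v ] numC4 (componentAt a)                ≡⟨ sum-cong-≗ numC4-componentAt ⟩
      ∑[ a < v ] ⟦ a ≺ m a ∧ U a ⟧                    ≡⟨ size-edgesOf M closed ⟨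
      size (edgesOf M U closed)                       ∎
      where open ≡-Reasoning

    length-vertices : 4 * numC4 components + 2 * numK2 components ≡ v
    length-vertices = trans (sym (length-compVerts components))
                            (trans (↭-length vertices↭) (length-tabulate (λ i → i)))

    isUnionC4K2 : IsUnionC4K2 G (numC4 components) (numK2 components)
    isUnionC4K2 = components , vertices↭ , (λ i j → mk⇔ adj⇒∈components ∈components⇒adj) , refl , refl

ExtremalUnion : (n : ℕ) → Graph (2 * n) → Set
ExtremalUnion n G = Σ ℕ λ a → Σ ℕ λ b → (2 * a + n ≡ e G) × (b + e G ≡ 2 * n) × IsUnionC4K2 G a b

K2-count : ∀ k b n e → 4 * k + 2 * b ≡ 2 * n → 2 * k + n ≡ e → b + e ≡ 2 * n
K2-count k b n e 4k+2b≡2n refl = begin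
  b + (2 * k + n)   ≡⟨ +-assoc b (2 * k) n ⟨
  (b + 2 * k) + n   ≡⟨ cong (_+ n) (+-comm b (2 * k)) ⟩
  (2 * k + b) + n   ≡⟨ cong (_+ n) half ⟩
  n + n             ≡⟨ cong (n +_) (+-identityʳ n) ⟨
  2 * n             ∎
  where
  open ≡-Reasoning
  half : 2 * k + b ≡ n
  half = *-cancelˡ-≡ (2 * k + b) n 2
           (trans (trans (*-distribˡ-+ 2 (2 * k) b) (cong (_+ 2 * b) (sym (*-assoc 2 2 k)))) 4k+2b≡2n)

module MaxForcingNumber {n : ℕ} {G : Graph (2 * n)} {k : ℕ} (isMax : IsMaxForcingNumber G k) where

  private
    M : PerfectMatching G
    M = proj₁ (proj₂ isMax)

    minimum : MinimumClosedForcingSet M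
    minimum = minimumClosedForcingSet M

    open MinimumClosedForcingSet minimum
    open MinimalForcingSet minimum

    s : ℕ
    s = size (edgesOf M U closed)

    k≤s : k ≤ s
    k≤s = proj₂ (proj₂ isMax) (edgesOf M U closed) (edgesOf-forcing M closed forces)

    doubled : 2 * n + 2 * count U ≡ 2 * (n + 2 * s)
    doubled = begin
      2 * n + 2 * count U   ≡⟨ cong (λ c → 2 * n + 2 * c) (2*size-edgesOf M closed) ⟨
      2 * n + 2 * (2 * s)   ≡⟨ *-distribˡ-+ 2 n (2 * s) ⟨
      2 * (n + 2 * s)       ∎
      where open ≡-Reasoning

    n+2s≤e : n + 2 * s ≤ e G
    n+2s≤e = *-cancelˡ-≤ 2 (subst (_≤ 2 * e G) doubled matching+forcingSet≤edges)

  upper-bound : 2 * k + n ≤ e G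
  upper-bound = begin
    2 * k + n   ≡⟨ +-comm (2 * k) n ⟩
    n + 2 * k   ≤⟨ +-monoʳ-≤ n (*-monoʳ-≤ 2 k≤s) ⟩
    n + 2 * s   ≤⟨ n+2s≤e ⟩
    e G         ∎
    where open ≤-Reasoning

  equality⇒union : 2 * k + n ≡ e G → ExtremalUnion n G
  equality⇒union 2k+n≡e =
    k , numK2 components , 2k+n≡e ,
    K2-count k (numK2 components) n (e G)
             (subst (λ a → 4 * a + 2 * numK2 components ≡ 2 * n) C4s≡k length-vertices) 2k+n≡e ,
    subst (λ a → IsUnionC4K2 G a (numK2 components)) C4s≡k isUnionC4K2
    where
    e≡n+2k : e G ≡ n + 2 * k
    e≡n+2k = trans (sym 2k+n≡e) (+-comm (2 * k) n)
    s≡k : s ≡ k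
    s≡k = ≤-antisym (*-cancelˡ-≤ 2 (+-cancelˡ-≤ n _ _ (≤-trans n+2s≤e (≤-reflexive e≡n+2k)))) k≤s
    tight : 2 * e G ≤ 2 * n + 2 * count U
    tight = ≤-reflexive (begin
      2 * e G               ≡⟨ cong (2 *_) e≡n+2k ⟩
      2 * (n + 2 * k)       ≡⟨ cong (λ x → 2 * (n + 2 * x)) s≡k ⟨
      2 * (n + 2 * s)       ≡⟨ doubled ⟨
      2 * n + 2 * count U   ∎)
      where open ≡-Reasoning
    open Tight tight
    C4s≡k : numC4 components ≡ k
    C4s≡k = trans numC4-components s≡k

  union⇒equality : ExtremalUnion n G → 2 * k + n ≡ e G
  union⇒equality (a , b , 2a+n≡e , _ , union) = trans (cong (λ x → 2 * x + n) k≡a) 2a+n≡e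
    where
    a≤k : a ≤ k
    a≤k with proj₁ isMax M
    ... | S , forcing , S≤k = ≤-trans (unionC4K2⇒C4s≤forcingSet union M S forcing) S≤k
    k≡a : k ≡ a
    k≡a = ≤-antisym (*-cancelˡ-≤ 2 (+-cancelʳ-≤ n _ _ (≤-trans upper-bound (≤-reflexive (sym 2a+n≡e)))))
                    a≤k

proposition3p2 : (n : ℕ) (G : Graph (2 * n)) → PerfectMatching G →
    Σ ℕ λ k → IsMaxForcingNumber G k
      × (2 * k + n ≤ e G)
      × ((2 * k + n ≡ e G) ⇔
          (Σ ℕ λ a → Σ ℕ λ b →
             (2 * a + n ≡ e G) × (b + e G ≡ 2 * n) × IsUnionC4K2 G a b))
proposition3p2 n G M₀ = k , isMax , upper-bound , mk⇔ equality⇒union union⇒equality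
  where
  k : ℕ
  k = proj₁ (maxForcingNumber M₀)
  isMax : IsMaxForcingNumber G k
  isMax = proj₂ (maxForcingNumber M₀)
  open MaxForcingNumber {n = n} isMax
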